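{- Let $g(x),f(x)$ be formal power series with integer coefficients and $g(0)=f(0)=1$, let $a_{n,k}=[x^n]g(x)(xf(x))^k$, let $\phi(x)$ be the reversion of $x/f(x)$, let $v(x)=xf(x)$ and $\bar v$ its reversion. For an integer $r\ge0$ let $c(A;r)$ be the lower-triangular matrix with $(n,k)$ entry $a_{2n+r,n+k+r}$. Then $$c(A;r)^{ -1}=\left(\frac{1}{\phi'\!\left(\frac{\bar v(x)}{f(\bar v(x))}\right)g(\bar v(x))f(\bar v(x))^{r-1}},\ \frac{\bar v(x)}{f(\bar v(x))}\right).$$
   Context: A Riordan array $(d(x),h(x))$, for formal power series $d,h$ with $d(0)\neq 0$, $h(0)=0$, $h'(0)\neq 0$, is the infinite lower-triangular matrix whose $(n,k)$ entry is $[x^n]d(x)h(x)^k$. Riordan arrays form a group under matrix multiplication, with $(d,h)\cdot(u,w)=(d(x)u(h(x)),w(h(x)))$ and $(d,h)^{ -1}=(1/d(\bar h),\bar h)$, where $\bar h$ is the reversion of $h$: the power series $u$ with $u(0)=0$ and $h(u(x))=x$. $\phi'$ denotes the derivative of $\phi$. -}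

module Defs where

open import Data.Nat using (ℕ; zero; suc; _∸_; _≟_)
import Data.Nat as N
open import Data.Integer using (ℤ; +_; _+_; _*_)
open import Data.Product using (_×_)
open import Relation.Nullary using (yes; no)
open import Relation.Binary.PropositionalEquality using (_≡_)

Series : Set
Series = ℕ → ℤ

_≈ₛ_ : Series → Series → Set
f ≈ₛ g = ∀ n → f n ≡ g n

sumTo : ℕ → (ℕ → ℤ) → ℤ
sumTo zero t = t zero
sumTo (suc n) t = sumTo n t + t (suc n)

δ : ℕ → ℕ → ℤ
δ n k with n ≟ k
... | yes _ = + 1
... | no _ = + 0

oneₛ : Series
oneₛ n = δ n 0

Xₛ : Series
Xₛ n = δ n 1

_⋆_ : Series → Series → Series
(f ⋆ g) n = sumTo n (λ i → f i * g (n ∸ i))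

powₛ : Series → ℕ → Series
powₛ f zero = oneₛ
powₛ f (suc k) = f ⋆ powₛ f k

-- composition f(h(x)) (meaningful when h 0 ≡ 0)
compₛ : Series → Series → Series
compₛ f h n = sumTo n (λ k → f k * powₛ h k n)

derivₛ : Series → Series
derivₛ f n = (+ suc n) * f (suc n)

IsInverse : Series → Series → Set
IsInverse d u = (d ⋆ u) ≈ₛ oneₛ

IsReversion : Series → Series → Set
IsReversion h u = (u 0 ≡ + 0) × (compₛ h u ≈ₛ Xₛ)

-- Riordan array (d,h): entry (n,k) = [x^n] d(x) h(x)^k
riordan : Series → Series → ℕ → ℕ → ℤ
riordan d h n k = (d ⋆ powₛ h k) n

aEntry : Series → Series → ℕ → ℕ → ℤ
aEntry g f n k = riordan g (Xₛ ⋆ f) n k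

cMat : Series → Series → ℕ → ℕ → ℕ → ℤ
cMat g f r n k = aEntry g f (n N.+ n N.+ r) (n N.+ k N.+ r)

-- product of lower-triangular matrices, (M N)_{n,k} = Σ_{j=0}^{n} M_{n,j} N_{j,k}
lowerMul : (ℕ → ℕ → ℤ) → (ℕ → ℕ → ℤ) → ℕ → ℕ → ℤ
lowerMul M P n k = sumTo n (λ j → M n j * P j k)

-- F^(r-1) for an invertible series F with inverse Finv (r-1 = -1 when r = 0)
powPred : Series → Series → ℕ → Series
powPred F Finv zero = Finv
powPred F Finv (suc s) = powₛ F s

-- Write v = x f and ψ = x / f, and let E = d(v). Row n of c(A;r) applied to a column s is the
-- coefficient [x^(2n+r)] g v^(n+r) s(v); since H = ψ(v̄) satisfies H(v) = ψ, the (n,k) entry of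
-- c(A;r) (d,H) is [x^(2n+r)] g v^(n+r) E ψ^k = [x^(n−k)] g f^(n+r−k) E. Composing the defining
-- identity of d with v and comparing with the chain rule (φ′ ∘ ψ) ψ′ = 1 gives g f^(r−1) E = ψ′,
-- so the entry is [x^m] f^(m+1) ψ′ with m = n − k, which is δ m 0 by the coefficient identity
-- behind Lagrange inversion. As c(A;r) is unitriangular, the right inverse is also a left inverse.

module Submission where

open import Defs
open import Algebra.Bundles using (AbelianGroup; CommutativeRing)
open import Algebra.Bundles.Raw using (RawRing)
open import Algebra.Solver.Ring.AlmostCommutativeRing
  using (AlmostCommutativeRing; _-Raw-AlmostCommutative⟶_)
open import Data.Empty using (⊥-elim)
open import Level using (0ℓ)
open import Data.Integer using (ℤ; +_; _+_; _*_; -_; -1ℤ)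
import Data.Integer as ℤ
import Data.Integer.Properties as ℤ
open import Algebra.Properties.CommutativeSemigroup ℤ.*-commutativeSemigroup using (x∙yz≈y∙xz)
open import Algebra.Properties.Group (AbelianGroup.group ℤ.+-0-abelianGroup) using (∙-cancelˡ)
open import Data.Integer.Tactic.RingSolver using (solve-∀)
open import Data.Maybe using (Maybe; just; nothing)
open import Data.Nat using (ℕ; zero; suc; _∸_; _≤_; _<_; z≤n; s≤s)
import Data.Nat as ℕ
open import Data.Nat.Induction using (<-rec)
import Data.Nat.Properties as ℕ
import Data.Nat.Tactic.RingSolver as ℕ-Solver
open import Data.Product using (_×_; _,_)
open import Data.Sum using (inj₁; inj₂)
open import Relation.Binary.Bundles using (Setoid)
open import Relation.Binary.PropositionalEquality
import Relation.Binary.Reasoning.Setoid as ≈-Reasoning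
open import Relation.Binary.Structures using (IsEquivalence)
open import Relation.Nullary using (yes; no; ¬_)

-- Finite sums

sumTo-cong-≤ : ∀ n {s t : ℕ → ℤ} → (∀ i → i ≤ n → s i ≡ t i) → sumTo n s ≡ sumTo n t
sumTo-cong-≤ zero eq = eq 0 z≤n
sumTo-cong-≤ (suc n) eq =
  cong₂ _+_ (sumTo-cong-≤ n (λ i i≤n → eq i (ℕ.m≤n⇒m≤1+n i≤n))) (eq (suc n) ℕ.≤-refl)

sumTo-cong : ∀ n {s t : ℕ → ℤ} → (∀ i → s i ≡ t i) → sumTo n s ≡ sumTo n t
sumTo-cong n eq = sumTo-cong-≤ n (λ i _ → eq i)

sumTo-+ : ∀ n (s t : ℕ → ℤ) → sumTo n (λ i → s i + t i) ≡ sumTo n s + sumTo n t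
sumTo-+ zero s t = refl
sumTo-+ (suc n) s t rewrite sumTo-+ n s t = interchange (sumTo n s) (sumTo n t) (s (suc n)) (t (suc n))
  where
  interchange : ∀ a b c d → (a + b) + (c + d) ≡ (a + c) + (b + d)
  interchange = solve-∀

sumTo-*ˡ : ∀ n c (s : ℕ → ℤ) → sumTo n (λ i → c * s i) ≡ c * sumTo n s
sumTo-*ˡ zero c s = refl
sumTo-*ˡ (suc n) c s rewrite sumTo-*ˡ n c s = sym (ℤ.*-distribˡ-+ c (sumTo n s) (s (suc n)))

sumTo-*ʳ : ∀ n c (s : ℕ → ℤ) → sumTo n (λ i → s i * c) ≡ sumTo n s * c
sumTo-*ʳ zero c s = refl
sumTo-*ʳ (suc n) c s rewrite sumTo-*ʳ n c s = sym (ℤ.*-distribʳ-+ c (sumTo n s) (s (suc n)))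

sumTo-neg : ∀ n (s : ℕ → ℤ) → sumTo n (λ i → - s i) ≡ - sumTo n s
sumTo-neg n s = begin
  sumTo n (λ i → - s i)     ≡⟨ sumTo-cong n (λ i → sym (ℤ.-1*i≡-i (s i))) ⟩
  sumTo n (λ i → -1ℤ * s i) ≡⟨ sumTo-*ˡ n -1ℤ s ⟩
  -1ℤ * sumTo n s           ≡⟨ ℤ.-1*i≡-i _ ⟩
  - sumTo n s               ∎
  where open ≡-Reasoning

sumTo-zero : ∀ n (s : ℕ → ℤ) → (∀ i → i ≤ n → s i ≡ + 0) → sumTo n s ≡ + 0
sumTo-zero zero s s≡0 = s≡0 0 z≤n
sumTo-zero (suc n) s s≡0
  rewrite sumTo-zero n s (λ i i≤n → s≡0 i (ℕ.m≤n⇒m≤1+n i≤n)) | s≡0 (suc n) ℕ.≤-refl = refl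

sumTo-unfoldˡ : ∀ n (s : ℕ → ℤ) → sumTo (suc n) s ≡ s 0 + sumTo n (λ i → s (suc i))
sumTo-unfoldˡ zero s = refl
sumTo-unfoldˡ (suc n) s rewrite sumTo-unfoldˡ n s = ℤ.+-assoc (s 0) _ _

sumTo-swap : ∀ n m (F : ℕ → ℕ → ℤ) →
  sumTo n (λ j → sumTo m (λ i → F i j)) ≡ sumTo m (λ i → sumTo n (λ j → F i j))
sumTo-swap zero m F = refl
sumTo-swap (suc n) m F rewrite sumTo-swap n m F =
  sym (sumTo-+ m (λ i → sumTo n (λ j → F i j)) (λ i → F i (suc n)))

sumTo-extend : ∀ {n} N (s : ℕ → ℤ) → n ≤ N → (∀ i → n < i → i ≤ N → s i ≡ + 0) →
  sumTo N s ≡ sumTo n s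
sumTo-extend {zero} zero s _ _ = refl
sumTo-extend {n} (suc N) s n≤1+N s≡0 with ℕ.m≤n⇒m<n∨m≡n n≤1+N
... | inj₂ refl = refl
... | inj₁ (s≤s n≤N)
  rewrite sumTo-extend N s n≤N (λ i n<i i≤N → s≡0 i n<i (ℕ.m≤n⇒m≤1+n i≤N))
        | s≡0 (suc N) (s≤s n≤N) ℕ.≤-refl = ℤ.+-identityʳ _

δ-≡ : ∀ {n k} → n ≡ k → δ n k ≡ + 1
δ-≡ {n} {k} n≡k with n ℕ.≟ k
... | yes _ = refl
... | no n≢k = ⊥-elim (n≢k n≡k)

δ-≢ : ∀ {n k} → ¬ n ≡ k → δ n k ≡ + 0
δ-≢ {n} {k} n≢k with n ℕ.≟ k
... | yes n≡k = ⊥-elim (n≢k n≡k)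
... | no _ = refl

δ-sym : ∀ n k → δ n k ≡ δ k n
δ-sym n k with n ℕ.≟ k
... | yes n≡k = sym (δ-≡ (sym n≡k))
... | no n≢k = sym (δ-≢ (λ k≡n → n≢k (sym k≡n)))

δ-+ˡ : ∀ k m → δ (k ℕ.+ m) k ≡ δ m 0
δ-+ˡ k zero = δ-≡ (ℕ.+-identityʳ k)
δ-+ˡ k (suc m) = δ-≢ (ℕ.m+1+n≢m k)

sumTo-*δ-< : ∀ n k (t : ℕ → ℤ) → n < k → sumTo n (λ j → t j * δ j k) ≡ + 0
sumTo-*δ-< n k t n<k = sumTo-zero n _ λ i i≤n →
  trans (cong (t i *_) (δ-≢ (λ i≡k → ℕ.<-irrefl i≡k (ℕ.≤-<-trans i≤n n<k)))) (ℤ.*-zeroʳ (t i))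

sumTo-*δ-≤ : ∀ n k (t : ℕ → ℤ) → k ≤ n → sumTo n (λ j → t j * δ j k) ≡ t k
sumTo-*δ-≤ zero .0 t z≤n = trans (cong (t 0 *_) (δ-≡ {0} refl)) (ℤ.*-identityʳ (t 0))
sumTo-*δ-≤ (suc n) k t k≤1+n with ℕ.m≤n⇒m<n∨m≡n k≤1+n
... | inj₂ refl = trans
  (cong₂ _+_ (sumTo-*δ-< n (suc n) t ℕ.≤-refl)
             (trans (cong (t (suc n) *_) (δ-≡ {suc n} refl)) (ℤ.*-identityʳ (t (suc n)))))
  (ℤ.+-identityˡ (t (suc n)))
... | inj₁ (s≤s k≤n) = trans
  (cong₂ _+_ (sumTo-*δ-≤ n k t k≤n)
             (trans (cong (t (suc n) *_) (δ-≢ (λ 1+n≡k → ℕ.<-irrefl (sym 1+n≡k) (s≤s k≤n))))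
                    (ℤ.*-zeroʳ (t (suc n)))))
  (ℤ.+-identityʳ (t k))

-- The ring of formal power series

tl : Series → Series
tl a n = a (suc n)

infixl 6 _⊕_
_⊕_ : Series → Series → Series
(a ⊕ b) n = a n + b n

⊖_ : Series → Series
(⊖ a) n = - a n

𝟘 : Series
𝟘 n = + 0

infixr 7 _·_
_·_ : ℤ → Series → Series
(c · a) n = c * a n

cst : ℤ → Series
cst c = c · oneₛ

≈ₛ-isEquivalence : IsEquivalence _≈ₛ_
≈ₛ-isEquivalence = record
  { refl = λ _ → refl ; sym = λ e n → sym (e n) ; trans = λ e e′ n → trans (e n) (e′ n) }

seriesSetoid : Setoid 0ℓ 0ℓ
seriesSetoid = record { isEquivalence = ≈ₛ-isEquivalence }

open Setoid seriesSetoid using () renaming (refl to ≈-refl; sym to ≈-sym; trans to ≈-trans)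

⊕-cong : ∀ {a a′ b b′} → a ≈ₛ a′ → b ≈ₛ b′ → (a ⊕ b) ≈ₛ (a′ ⊕ b′)
⊕-cong e e′ n = cong₂ _+_ (e n) (e′ n)

⊕-congˡ : ∀ {a a′} b → a ≈ₛ a′ → (a ⊕ b) ≈ₛ (a′ ⊕ b)
⊕-congˡ b e = ⊕-cong e (λ _ → refl)

⊕-congʳ : ∀ a {b b′} → b ≈ₛ b′ → (a ⊕ b) ≈ₛ (a ⊕ b′)
⊕-congʳ a = ⊕-cong {a} (λ _ → refl)

⋆-unfold : ∀ a b n → (a ⋆ b) (suc n) ≡ a 0 * b (suc n) + (tl a ⋆ b) n
⋆-unfold a b n = sumTo-unfoldˡ n _

⋆-congˡ : ∀ {a a′} b → a ≈ₛ a′ → (a ⋆ b) ≈ₛ (a′ ⋆ b)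
⋆-congˡ b e n = sumTo-cong n (λ i → cong (_* b (n ∸ i)) (e i))

⋆-congʳ : ∀ a {b b′} → b ≈ₛ b′ → (a ⋆ b) ≈ₛ (a ⋆ b′)
⋆-congʳ a e n = sumTo-cong n (λ i → cong (a i *_) (e (n ∸ i)))

⋆-cong : ∀ {a a′ b b′} → a ≈ₛ a′ → b ≈ₛ b′ → (a ⋆ b) ≈ₛ (a′ ⋆ b′)
⋆-cong {a′ = a′} {b = b} e e′ = ≈-trans (⋆-congˡ b e) (⋆-congʳ a′ e′)

⋆-distribʳ : ∀ a b c → ((a ⊕ b) ⋆ c) ≈ₛ ((a ⋆ c) ⊕ (b ⋆ c))
⋆-distribʳ a b c n =
  trans (sumTo-cong n (λ i → ℤ.*-distribʳ-+ (c (n ∸ i)) (a i) (b i))) (sumTo-+ n _ _)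

·-⋆ : ∀ c a b → ((c · a) ⋆ b) ≈ₛ (c · (a ⋆ b))
·-⋆ c a b n = trans (sumTo-cong n (λ i → ℤ.*-assoc c (a i) (b (n ∸ i)))) (sumTo-*ˡ n c _)

⊖-⋆ : ∀ a b → ((⊖ a) ⋆ b) ≈ₛ (⊖ (a ⋆ b))
⊖-⋆ a b n =
  trans (sumTo-cong n (λ i → sym (ℤ.neg-distribˡ-* (a i) (b (n ∸ i))))) (sumTo-neg n _)

⋆-comm : ∀ a b → (a ⋆ b) ≈ₛ (b ⋆ a)
⋆-comm a b zero = ℤ.*-comm (a 0) (b 0)
⋆-comm a b (suc zero) = swap (a 0) (a 1) (b 0) (b 1)
  where
  swap : ∀ a₀ a₁ b₀ b₁ → a₀ * b₁ + a₁ * b₀ ≡ b₀ * a₁ + b₁ * a₀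
  swap = solve-∀
⋆-comm a b (suc (suc m)) = begin
  (a ⋆ b) (2+ m)                                         ≡⟨ ⋆-unfold a b (suc m) ⟩
  a 0 * b (2+ m) + (tl a ⋆ b) (suc m)                   ≡⟨ cong (_+_ (a 0 * b (2+ m))) (⋆-comm (tl a) b (suc m)) ⟩
  a 0 * b (2+ m) + (b ⋆ tl a) (suc m)                   ≡⟨ cong (_+_ (a 0 * b (2+ m))) (⋆-unfold b (tl a) m) ⟩
  a 0 * b (2+ m) + (b 0 * a (2+ m) + (tl b ⋆ tl a) m)   ≡⟨ exchange (a 0 * b (2+ m)) (b 0 * a (2+ m)) _ ⟩
  b 0 * a (2+ m) + (a 0 * b (2+ m) + (tl b ⋆ tl a) m)   ≡⟨ cong (λ z → b 0 * a (2+ m) + (a 0 * b (2+ m) + z)) (⋆-comm (tl b) (tl a) m) ⟩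
  b 0 * a (2+ m) + (a 0 * b (2+ m) + (tl a ⋆ tl b) m)   ≡⟨ cong (_+_ (b 0 * a (2+ m))) (sym (⋆-unfold a (tl b) m)) ⟩
  b 0 * a (2+ m) + (a ⋆ tl b) (suc m)                   ≡⟨ cong (_+_ (b 0 * a (2+ m))) (⋆-comm a (tl b) (suc m)) ⟩
  b 0 * a (2+ m) + (tl b ⋆ a) (suc m)                   ≡⟨ sym (⋆-unfold b a (suc m)) ⟩
  (b ⋆ a) (2+ m)                                         ∎
  where
  open ≡-Reasoning
  2+ : ℕ → ℕ
  2+ m = suc (suc m)
  exchange : ∀ x y z → x + (y + z) ≡ y + (x + z)
  exchange = solve-∀

tl-⋆ : ∀ a b → tl (a ⋆ b) ≈ₛ ((a 0 · tl b) ⊕ (tl a ⋆ b))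
tl-⋆ a b = ⋆-unfold a b

⋆-assoc : ∀ a b c → ((a ⋆ b) ⋆ c) ≈ₛ (a ⋆ (b ⋆ c))
⋆-assoc a b c zero = ℤ.*-assoc (a 0) (b 0) (c 0)
⋆-assoc a b c (suc n) = begin
  ((a ⋆ b) ⋆ c) (suc n)                                 ≡⟨ ⋆-unfold (a ⋆ b) c n ⟩
  (a 0 * b 0) * c (suc n) + (tl (a ⋆ b) ⋆ c) n          ≡⟨ cong (_+_ ((a 0 * b 0) * c (suc n))) tail ⟩
  (a 0 * b 0) * c (suc n) + (a 0 * (tl b ⋆ c) n + (tl a ⋆ (b ⋆ c)) n)
                                                         ≡⟨ regroup (a 0) (b 0) (c (suc n)) ((tl b ⋆ c) n) ((tl a ⋆ (b ⋆ c)) n) ⟩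
  a 0 * (b 0 * c (suc n) + (tl b ⋆ c) n) + (tl a ⋆ (b ⋆ c)) n
                                                         ≡⟨ cong (λ z → a 0 * z + (tl a ⋆ (b ⋆ c)) n) (sym (⋆-unfold b c n)) ⟩
  a 0 * (b ⋆ c) (suc n) + (tl a ⋆ (b ⋆ c)) n            ≡⟨ sym (⋆-unfold a (b ⋆ c) n) ⟩
  (a ⋆ (b ⋆ c)) (suc n)                                 ∎
  where
  open ≡-Reasoning
  regroup : ∀ x y z u w → (x * y) * z + (x * u + w) ≡ x * (y * z + u) + w
  regroup = solve-∀
  tail : (tl (a ⋆ b) ⋆ c) n ≡ a 0 * (tl b ⋆ c) n + (tl a ⋆ (b ⋆ c)) n
  tail = trans (⋆-congˡ c (tl-⋆ a b) n)
        (trans (⋆-distribʳ (a 0 · tl b) (tl a ⋆ b) c n)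
               (cong₂ _+_ (·-⋆ (a 0) (tl b) c n) (⋆-assoc (tl a) b c n)))

⋆-identityˡ : ∀ a → (oneₛ ⋆ a) ≈ₛ a
⋆-identityˡ a zero = ℤ.*-identityˡ (a 0)
⋆-identityˡ a (suc n) = begin
  (oneₛ ⋆ a) (suc n)                   ≡⟨ ⋆-unfold oneₛ a n ⟩
  + 1 * a (suc n) + (tl oneₛ ⋆ a) n    ≡⟨ cong (_+_ (+ 1 * a (suc n))) (sumTo-zero n _ (λ _ _ → refl)) ⟩
  + 1 * a (suc n) + + 0                ≡⟨ ℤ.+-identityʳ _ ⟩
  + 1 * a (suc n)                      ≡⟨ ℤ.*-identityˡ _ ⟩
  a (suc n)                            ∎
  where open ≡-Reasoning

⋆-zeroˡ : ∀ a → (𝟘 ⋆ a) ≈ₛ 𝟘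
⋆-zeroˡ a n = sumTo-zero n _ (λ _ _ → refl)

cst-⋆ : ∀ c a → (cst c ⋆ a) ≈ₛ (c · a)
cst-⋆ c a n = trans (·-⋆ c oneₛ a n) (cong (c *_) (⋆-identityˡ a n))

tl-Xₛ : tl Xₛ ≈ₛ oneₛ
tl-Xₛ zero = refl
tl-Xₛ (suc n) = refl

Xₛ-⋆ : ∀ a n → (Xₛ ⋆ a) (suc n) ≡ a n
Xₛ-⋆ a n = begin
  (Xₛ ⋆ a) (suc n)                     ≡⟨ ⋆-unfold Xₛ a n ⟩
  + 0 * a (suc n) + (tl Xₛ ⋆ a) n      ≡⟨ ℤ.+-identityˡ _ ⟩
  (tl Xₛ ⋆ a) n                        ≡⟨ ⋆-congˡ a tl-Xₛ n ⟩
  (oneₛ ⋆ a) n                         ≡⟨ ⋆-identityˡ a n ⟩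
  a n                                  ∎
  where open ≡-Reasoning

series-unfold : ∀ a → a ≈ₛ (cst (a 0) ⊕ (Xₛ ⋆ tl a))
series-unfold a zero = sym (trans (ℤ.+-identityʳ _) (ℤ.*-identityʳ _))
series-unfold a (suc n) = sym (begin
  a 0 * + 0 + (Xₛ ⋆ tl a) (suc n)  ≡⟨ cong₂ _+_ (ℤ.*-zeroʳ (a 0)) (Xₛ-⋆ (tl a) n) ⟩
  + 0 + a (suc n)                  ≡⟨ ℤ.+-identityˡ _ ⟩
  a (suc n)                        ∎)
  where open ≡-Reasoning

module _ where
  open import Algebra.Structures _≈ₛ_
  open import Algebra.Structures.Biased _≈ₛ_

  ⊕-isCommutativeMonoid : IsCommutativeMonoid _⊕_ 𝟘
  ⊕-isCommutativeMonoid = isCommutativeMonoidˡ record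
    { isSemigroup = record
      { isMagma = record { isEquivalence = ≈ₛ-isEquivalence ; ∙-cong = ⊕-cong }
      ; assoc = λ a b c n → ℤ.+-assoc (a n) (b n) (c n) }
    ; identityˡ = λ a n → ℤ.+-identityˡ (a n)
    ; comm = λ a b n → ℤ.+-comm (a n) (b n) }

  ⋆-isCommutativeMonoid : IsCommutativeMonoid _⋆_ oneₛ
  ⋆-isCommutativeMonoid = isCommutativeMonoidˡ record
    { isSemigroup = record
      { isMagma = record { isEquivalence = ≈ₛ-isEquivalence ; ∙-cong = ⋆-cong }
      ; assoc = ⋆-assoc }
    ; identityˡ = ⋆-identityˡ
    ; comm = ⋆-comm }

  seriesRing : AlmostCommutativeRing 0ℓ 0ℓ
  seriesRing = record
    { Carrier = Series ; _≈_ = _≈ₛ_ ; _+_ = _⊕_ ; _*_ = _⋆_ ; -_ = ⊖_ ; 0# = 𝟘 ; 1# = oneₛ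
    ; isAlmostCommutativeRing = record
      { isCommutativeSemiring = isCommutativeSemiringˡ record
        { +-isCommutativeMonoid = ⊕-isCommutativeMonoid
        ; *-isCommutativeMonoid = ⋆-isCommutativeMonoid
        ; distribʳ = λ c a b → ⋆-distribʳ a b c
        ; zeroˡ = ⋆-zeroˡ }
      ; -‿cong = λ e n → cong -_ (e n)
      ; -‿*-distribˡ = ⊖-⋆
      ; -‿+-comm = λ a b n → sym (ℤ.neg-distrib-+ (a n) (b n))
      } }

ℤ-rawRing : RawRing 0ℓ 0ℓ
ℤ-rawRing = CommutativeRing.rawRing ℤ.+-*-commutativeRing

cst-homomorphism : ℤ-rawRing -Raw-AlmostCommutative⟶ seriesRing
cst-homomorphism = record
  { ⟦_⟧ = cst
  ; +-homo = λ a b n → ℤ.*-distribʳ-+ (oneₛ n) a b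
  ; *-homo = λ a b n → trans (ℤ.*-assoc a b (oneₛ n)) (sym (cst-⋆ a (cst b) n))
  ; -‿homo = λ a n → sym (ℤ.neg-distribˡ-* a (oneₛ n))
  ; 0-homo = λ n → ℤ.*-zeroˡ (oneₛ n)
  ; 1-homo = λ n → ℤ.*-identityˡ (oneₛ n)
  }

cst-≟ : ∀ a b → Maybe (cst a ≈ₛ cst b)
cst-≟ a b with a ℤ.≟ b
... | yes refl = just ≈-refl
... | no _ = nothing

open import Algebra.Solver.Ring ℤ-rawRing seriesRing cst-homomorphism cst-≟
  using (solve; _:=_; con; _:+_; _:*_; :-_)

-- Order and composition

VanishesBelow : Series → ℕ → Set
VanishesBelow a p = ∀ i → i < p → a i ≡ + 0

∸-<-bound : ∀ {N p i} q → N < p ℕ.+ q → p ≤ i → i ≤ N → N ∸ i < q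
∸-<-bound {N} {p} zero N<p+0 p≤i i≤N =
  ⊥-elim (ℕ.<-irrefl refl (ℕ.<-≤-trans N<p+0 (subst (_≤ N) (sym (ℕ.+-identityʳ p)) (ℕ.≤-trans p≤i i≤N))))
∸-<-bound {N} {p} (suc q) N<p+q p≤i _ = ℕ.≤-<-trans (ℕ.∸-monoʳ-≤ N p≤i) (ℕ.m<n+o⇒m∸n<o N p N<p+q)

vanishesBelow-⋆ : ∀ {a b p q} → VanishesBelow a p → VanishesBelow b q → VanishesBelow (a ⋆ b) (p ℕ.+ q)
vanishesBelow-⋆ {a} {b} {p} {q} a≈0 b≈0 N N<p+q = sumTo-zero N _ term≡0
  where
  term≡0 : ∀ i → i ≤ N → a i * b (N ∸ i) ≡ + 0
  term≡0 i i≤N with ℕ.<-≤-connex i p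
  ... | inj₁ i<p rewrite a≈0 i i<p = ℤ.*-zeroˡ (b (N ∸ i))
  ... | inj₂ p≤i rewrite b≈0 (N ∸ i) (∸-<-bound q N<p+q p≤i i≤N) = ℤ.*-zeroʳ (a i)

vanishesBelow-pow : ∀ h → h 0 ≡ + 0 → ∀ k → VanishesBelow (powₛ h k) k
vanishesBelow-pow h h0 zero i ()
vanishesBelow-pow h h0 (suc k) =
  vanishesBelow-⋆ {h} {powₛ h k} {1} (λ { .0 (s≤s z≤n) → h0 }) (vanishesBelow-pow h h0 k)

powₛ-cong : ∀ {a a′} → a ≈ₛ a′ → ∀ k → powₛ a k ≈ₛ powₛ a′ k
powₛ-cong e zero = ≈-refl
powₛ-cong e (suc k) = ⋆-cong e (powₛ-cong e k)

powₛ-+ : ∀ a p q → powₛ a (p ℕ.+ q) ≈ₛ (powₛ a p ⋆ powₛ a q)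
powₛ-+ a zero q = ≈-sym (⋆-identityˡ (powₛ a q))
powₛ-+ a (suc p) q = ≈-trans (⋆-congʳ a (powₛ-+ a p q)) (≈-sym (⋆-assoc a (powₛ a p) (powₛ a q)))

powₛ-⋆ : ∀ a b p → powₛ (a ⋆ b) p ≈ₛ (powₛ a p ⋆ powₛ b p)
powₛ-⋆ a b zero = ≈-sym (⋆-identityˡ oneₛ)
powₛ-⋆ a b (suc p) = ≈-trans (⋆-congʳ (a ⋆ b) (powₛ-⋆ a b p))
  (solve 4 (λ a b x y → (a :* b) :* (x :* y) := (a :* x) :* (b :* y)) ≈-refl a b (powₛ a p) (powₛ b p))

powₛ-oneₛ : ∀ p → powₛ oneₛ p ≈ₛ oneₛ
powₛ-oneₛ zero = ≈-refl
powₛ-oneₛ (suc p) = ≈-trans (⋆-identityˡ (powₛ oneₛ p)) (powₛ-oneₛ p)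

powₛ-zeroCoeff : ∀ a → a 0 ≡ + 1 → ∀ p → powₛ a p 0 ≡ + 1
powₛ-zeroCoeff a a0 zero = refl
powₛ-zeroCoeff a a0 (suc p) rewrite a0 | powₛ-zeroCoeff a a0 p = refl

powₛ-Xₛ-⋆-shift : ∀ p s q → (powₛ Xₛ p ⋆ s) (p ℕ.+ q) ≡ s q
powₛ-Xₛ-⋆-shift zero s q = ⋆-identityˡ s q
powₛ-Xₛ-⋆-shift (suc p) s q = begin
  ((Xₛ ⋆ powₛ Xₛ p) ⋆ s) (suc (p ℕ.+ q))  ≡⟨ ⋆-assoc Xₛ (powₛ Xₛ p) s (suc (p ℕ.+ q)) ⟩
  (Xₛ ⋆ (powₛ Xₛ p ⋆ s)) (suc (p ℕ.+ q))  ≡⟨ Xₛ-⋆ (powₛ Xₛ p ⋆ s) (p ℕ.+ q) ⟩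
  (powₛ Xₛ p ⋆ s) (p ℕ.+ q)               ≡⟨ powₛ-Xₛ-⋆-shift p s q ⟩
  s q                                      ∎
  where open ≡-Reasoning

powₛ-Xₛ-⋆-vanishesBelow : ∀ p s → VanishesBelow (powₛ Xₛ p ⋆ s) p
powₛ-Xₛ-⋆-vanishesBelow p s i i<p =
  vanishesBelow-⋆ {powₛ Xₛ p} {s} {p} {0} (vanishesBelow-pow Xₛ refl p) (λ _ ()) i
    (subst (i <_) (sym (ℕ.+-identityʳ p)) i<p)

compₛ-extend : ∀ a h → h 0 ≡ + 0 → ∀ {n} N → n ≤ N → compₛ a h n ≡ sumTo N (λ k → a k * powₛ h k n)
compₛ-extend a h h0 {n} N n≤N = sym (sumTo-extend N _ n≤N λ k n<k _ →
  trans (cong (a k *_) (vanishesBelow-pow h h0 k n n<k)) (ℤ.*-zeroʳ (a k)))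

⋆-compₛ : ∀ t s h → h 0 ≡ + 0 → ∀ N → (t ⋆ compₛ s h) N ≡ sumTo N (λ j → s j * (t ⋆ powₛ h j) N)
⋆-compₛ t s h h0 N = begin
  sumTo N (λ i → t i * compₛ s h (N ∸ i))
    ≡⟨ sumTo-cong N (λ i → cong (t i *_) (compₛ-extend s h h0 N (ℕ.m∸n≤m N i))) ⟩
  sumTo N (λ i → t i * sumTo N (λ j → s j * powₛ h j (N ∸ i)))
    ≡⟨ sumTo-cong N (λ i → sym (sumTo-*ˡ N (t i) _)) ⟩
  sumTo N (λ i → sumTo N (λ j → t i * (s j * powₛ h j (N ∸ i))))
    ≡⟨ sumTo-swap N N (λ j i → t i * (s j * powₛ h j (N ∸ i))) ⟩
  sumTo N (λ j → sumTo N (λ i → t i * (s j * powₛ h j (N ∸ i))))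
    ≡⟨ sumTo-cong N (λ j → trans (sumTo-cong N (λ i → x∙yz≈y∙xz (t i) (s j) _)) (sumTo-*ˡ N (s j) _)) ⟩
  sumTo N (λ j → s j * (t ⋆ powₛ h j) N)
    ∎
  where open ≡-Reasoning

compₛ-unfold : ∀ a h → h 0 ≡ + 0 → compₛ a h ≈ₛ (cst (a 0) ⊕ (h ⋆ compₛ (tl a) h))
compₛ-unfold a h h0 zero rewrite h0 =
  sym (trans (cong (_+_ (a 0 * + 1)) (ℤ.*-zeroˡ (compₛ (tl a) h 0))) (ℤ.+-identityʳ _))
compₛ-unfold a h h0 (suc m) = begin
  sumTo (suc m) (λ k → a k * powₛ h k (suc m))
    ≡⟨ sumTo-unfoldˡ m _ ⟩
  a 0 * + 0 + sumTo m (λ k → a (suc k) * powₛ h (suc k) (suc m))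
    ≡⟨ cong (_+_ (a 0 * + 0)) (sym (sumTo-extend (suc m) _ (ℕ.n≤1+n m) high-terms)) ⟩
  a 0 * + 0 + sumTo (suc m) (λ k → a (suc k) * powₛ h (suc k) (suc m))
    ≡⟨ cong (_+_ (a 0 * + 0)) (sym (⋆-compₛ h (tl a) h h0 (suc m))) ⟩
  a 0 * + 0 + (h ⋆ compₛ (tl a) h) (suc m)
    ∎
  where
  open ≡-Reasoning
  high-terms : ∀ i → m < i → i ≤ suc m → a (suc i) * powₛ h (suc i) (suc m) ≡ + 0
  high-terms i m<i _ =
    trans (cong (a (suc i) *_) (vanishesBelow-pow h h0 (suc i) (suc m) (s≤s m<i))) (ℤ.*-zeroʳ (a (suc i)))

-- Coefficient n of h ⋆ s only involves s below n, which makes the unfolding a recursion.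
≡-via-unfolding : ∀ {L R} F h A B → h 0 ≡ + 0 → L ≈ₛ (F ⊕ (h ⋆ A)) → (F ⊕ (h ⋆ B)) ≈ₛ R →
  ∀ n → (∀ {i} → i < n → A i ≡ B i) → L n ≡ R n
≡-via-unfolding {L} {R} F h A B h0 L≈ R≈ n A≡B = trans (L≈ n) (trans (cong (_+_ (F n)) (agree n A≡B)) (R≈ n))
  where
  agree : ∀ n → (∀ {i} → i < n → A i ≡ B i) → (h ⋆ A) n ≡ (h ⋆ B) n
  agree zero _ rewrite h0 = trans (ℤ.*-zeroˡ (A 0)) (sym (ℤ.*-zeroˡ (B 0)))
  agree (suc m) A≡B rewrite ⋆-unfold h A m | ⋆-unfold h B m | h0 =
    cong₂ _+_ (trans (ℤ.*-zeroˡ (A (suc m))) (sym (ℤ.*-zeroˡ (B (suc m)))))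
              (sumTo-cong-≤ m (λ i _ → cong (h (suc i) *_) (A≡B (s≤s (ℕ.m∸n≤m m i)))))

compₛ-congˡ : ∀ {a a′} h → a ≈ₛ a′ → compₛ a h ≈ₛ compₛ a′ h
compₛ-congˡ h e n = sumTo-cong n (λ k → cong (_* powₛ h k n) (e k))

compₛ-congʳ : ∀ a {h h′} → h ≈ₛ h′ → compₛ a h ≈ₛ compₛ a h′
compₛ-congʳ a e n = sumTo-cong n (λ k → cong (a k *_) (powₛ-cong e k n))

compₛ-⊕ : ∀ a b h → compₛ (a ⊕ b) h ≈ₛ (compₛ a h ⊕ compₛ b h)
compₛ-⊕ a b h n = trans (sumTo-cong n (λ k → ℤ.*-distribʳ-+ (powₛ h k n) (a k) (b k))) (sumTo-+ n _ _)

compₛ-· : ∀ c a h → compₛ (c · a) h ≈ₛ (c · compₛ a h)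
compₛ-· c a h n = trans (sumTo-cong n (λ k → ℤ.*-assoc c (a k) (powₛ h k n))) (sumTo-*ˡ n c _)

compₛ-⊖ : ∀ a h → compₛ (⊖ a) h ≈ₛ (⊖ compₛ a h)
compₛ-⊖ a h n = trans (sumTo-cong n (λ k → sym (ℤ.neg-distribˡ-* (a k) (powₛ h k n)))) (sumTo-neg n _)

compₛ-𝟘 : ∀ h → compₛ 𝟘 h ≈ₛ 𝟘
compₛ-𝟘 h n = sumTo-zero n _ (λ k _ → ℤ.*-zeroˡ (powₛ h k n))

compₛ-oneₛ : ∀ h → h 0 ≡ + 0 → compₛ oneₛ h ≈ₛ oneₛ
compₛ-oneₛ h h0 = begin
  compₛ oneₛ h                                ≈⟨ compₛ-unfold oneₛ h h0 ⟩
  cst (+ 1) ⊕ (h ⋆ compₛ (tl oneₛ) h)         ≈⟨ ⊕-congʳ (cst (+ 1)) (⋆-congʳ h (compₛ-𝟘 h)) ⟩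
  cst (+ 1) ⊕ (h ⋆ 𝟘)                         ≈⟨ ⊕-cong (λ n → ℤ.*-identityˡ (oneₛ n)) (≈-trans (⋆-comm h 𝟘) (⋆-zeroˡ h)) ⟩
  oneₛ ⊕ 𝟘                                    ≈⟨ (λ n → ℤ.+-identityʳ (oneₛ n)) ⟩
  oneₛ                                        ∎
  where open ≈-Reasoning seriesSetoid

compₛ-cst : ∀ h → h 0 ≡ + 0 → ∀ c → compₛ (cst c) h ≈ₛ cst c
compₛ-cst h h0 c = ≈-trans (compₛ-· c oneₛ h) (λ n → cong (c *_) (compₛ-oneₛ h h0 n))

compₛ-⋆ : ∀ h → h 0 ≡ + 0 → ∀ a b → compₛ (a ⋆ b) h ≈ₛ (compₛ a h ⋆ compₛ b h)
compₛ-⋆ h h0 a₀ b₀ n = <-rec P step n a₀ b₀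
  where
  P : ℕ → Set
  P n = ∀ a b → compₛ (a ⋆ b) h n ≡ (compₛ a h ⋆ compₛ b h) n
  step : ∀ n → (∀ {i} → i < n → P i) → P n
  step n IH a b = ≡-via-unfolding (cst (a 0 * b 0)) h A B h0 lhs rhs n (λ {i} i<n → cong (_+_ (A₀ i)) (IH i<n (tl a) b))
    where
    open ≈-Reasoning seriesSetoid
    ca cb a′ b′ A₀ A B : Series
    ca = cst (a 0)
    cb = cst (b 0)
    a′ = compₛ (tl a) h
    b′ = compₛ (tl b) h
    A₀ = a 0 · b′
    A = A₀ ⊕ compₛ (tl a ⋆ b) h
    B = A₀ ⊕ (a′ ⋆ compₛ b h)
    lhs : compₛ (a ⋆ b) h ≈ₛ (cst (a 0 * b 0) ⊕ (h ⋆ A))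
    lhs = begin
      compₛ (a ⋆ b) h                                   ≈⟨ compₛ-unfold (a ⋆ b) h h0 ⟩
      cst (a 0 * b 0) ⊕ (h ⋆ compₛ (tl (a ⋆ b)) h)      ≈⟨ ⊕-congʳ (cst (a 0 * b 0)) (⋆-congʳ h tail) ⟩
      cst (a 0 * b 0) ⊕ (h ⋆ A)                         ∎
      where
      tail : compₛ (tl (a ⋆ b)) h ≈ₛ A
      tail = ≈-trans (compₛ-congˡ h (tl-⋆ a b))
        (≈-trans (compₛ-⊕ (a 0 · tl b) (tl a ⋆ b) h) (⊕-congˡ (compₛ (tl a ⋆ b) h) (compₛ-· (a 0) (tl b) h)))
    rhs : (cst (a 0 * b 0) ⊕ (h ⋆ B)) ≈ₛ (compₛ a h ⋆ compₛ b h)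
    rhs = begin
      cst (a 0 * b 0) ⊕ (h ⋆ B)
        ≈⟨ ⊕-cong (_-Raw-AlmostCommutative⟶_.*-homo cst-homomorphism (a 0) (b 0))
                  (⋆-congʳ h (⊕-cong (≈-sym (cst-⋆ (a 0) b′)) (⋆-congʳ a′ (compₛ-unfold b h h0)))) ⟩
      (ca ⋆ cb) ⊕ (h ⋆ ((ca ⋆ b′) ⊕ (a′ ⋆ (cb ⊕ (h ⋆ b′)))))
        ≈⟨ solve 5 (λ ca cb h a′ b′ → (ca :* cb) :+ (h :* ((ca :* b′) :+ (a′ :* (cb :+ (h :* b′)))))
                                     := (ca :+ (h :* a′)) :* (cb :+ (h :* b′))) ≈-refl ca cb h a′ b′ ⟩
      (ca ⊕ (h ⋆ a′)) ⋆ (cb ⊕ (h ⋆ b′))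
        ≈⟨ ⋆-cong (≈-sym (compₛ-unfold a h h0)) (≈-sym (compₛ-unfold b h h0)) ⟩
      compₛ a h ⋆ compₛ b h
        ∎

compₛ-pow : ∀ h → h 0 ≡ + 0 → ∀ a k → compₛ (powₛ a k) h ≈ₛ powₛ (compₛ a h) k
compₛ-pow h h0 a zero = compₛ-oneₛ h h0
compₛ-pow h h0 a (suc k) = ≈-trans (compₛ-⋆ h h0 a (powₛ a k)) (⋆-congʳ (compₛ a h) (compₛ-pow h h0 a k))

compₛ-powPred : ∀ h → h 0 ≡ + 0 → ∀ a b r → compₛ (powPred a b r) h ≈ₛ powPred (compₛ a h) (compₛ b h) r
compₛ-powPred h h0 a b zero = ≈-refl
compₛ-powPred h h0 a b (suc r) = compₛ-pow h h0 a r

Xₛ-compₛ : ∀ h → h 0 ≡ + 0 → compₛ Xₛ h ≈ₛ h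
Xₛ-compₛ h h0 = begin
  compₛ Xₛ h                              ≈⟨ compₛ-unfold Xₛ h h0 ⟩
  cst (+ 0) ⊕ (h ⋆ compₛ (tl Xₛ) h)       ≈⟨ ⊕-congʳ (cst (+ 0)) (⋆-congʳ h (≈-trans (compₛ-congˡ h tl-Xₛ) (compₛ-oneₛ h h0))) ⟩
  cst (+ 0) ⊕ (h ⋆ oneₛ)                  ≈⟨ ⊕-cong (λ n → ℤ.*-zeroˡ (oneₛ n)) (≈-trans (⋆-comm h oneₛ) (⋆-identityˡ h)) ⟩
  𝟘 ⊕ h                                   ≈⟨ (λ n → ℤ.+-identityˡ (h n)) ⟩
  h                                       ∎
  where open ≈-Reasoning seriesSetoid

compₛ-Xₛ : ∀ a → compₛ a Xₛ ≈ₛ a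
compₛ-Xₛ a₀ n = <-rec (λ n → ∀ a → compₛ a Xₛ n ≡ a n) step n a₀
  where
  step : ∀ n → (∀ {i} → i < n → ∀ a → compₛ a Xₛ i ≡ a i) → ∀ a → compₛ a Xₛ n ≡ a n
  step n IH a = ≡-via-unfolding (cst (a 0)) Xₛ (compₛ (tl a) Xₛ) (tl a) refl (compₛ-unfold a Xₛ refl)
    (≈-sym (series-unfold a)) n (λ i<n → IH i<n (tl a))

compₛ-assoc : ∀ h w → h 0 ≡ + 0 → w 0 ≡ + 0 → ∀ a → compₛ (compₛ a h) w ≈ₛ compₛ a (compₛ h w)
compₛ-assoc h w h0 w0 a₀ n = <-rec P step n a₀
  where
  h∘w : Series
  h∘w = compₛ h w
  h∘w0 : h∘w 0 ≡ + 0
  h∘w0 rewrite h0 = refl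
  P : ℕ → Set
  P n = ∀ a → compₛ (compₛ a h) w n ≡ compₛ a h∘w n
  step : ∀ n → (∀ {i} → i < n → P i) → P n
  step n IH a = ≡-via-unfolding (cst (a 0)) h∘w (compₛ (compₛ (tl a) h) w) (compₛ (tl a) h∘w) h∘w0 lhs
    (≈-sym (compₛ-unfold a h∘w h∘w0)) n (λ i<n → IH i<n (tl a))
    where
    lhs : compₛ (compₛ a h) w ≈ₛ (cst (a 0) ⊕ (h∘w ⋆ compₛ (compₛ (tl a) h) w))
    lhs = ≈-trans (compₛ-congˡ w (compₛ-unfold a h h0))
      (≈-trans (compₛ-⊕ (cst (a 0)) (h ⋆ compₛ (tl a) h) w)
               (⊕-cong (compₛ-cst w w0 (a 0)) (compₛ-⋆ w w0 h (compₛ (tl a) h))))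

⋆-cancel-unit : ∀ a s → a 0 ≡ + 1 → (a ⋆ s) ≈ₛ 𝟘 → s ≈ₛ 𝟘
⋆-cancel-unit a s a0 a⋆s≈0 = <-rec (λ n → s n ≡ + 0) step
  where
  step : ∀ n → (∀ {i} → i < n → s i ≡ + 0) → s n ≡ + 0
  step zero _ = trans (sym (ℤ.*-identityˡ (s 0))) (trans (cong (_* s 0) (sym a0)) (a⋆s≈0 0))
  step (suc m) IH = begin
    s (suc m)                              ≡⟨ sym (ℤ.+-identityʳ (s (suc m))) ⟩
    s (suc m) + + 0                        ≡⟨ cong₂ _+_ leading (sym lower) ⟩
    a 0 * s (suc m) + (tl a ⋆ s) m         ≡⟨ sym (⋆-unfold a s m) ⟩
    (a ⋆ s) (suc m)                        ≡⟨ a⋆s≈0 (suc m) ⟩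
    + 0                                    ∎
    where
    open ≡-Reasoning
    leading : s (suc m) ≡ a 0 * s (suc m)
    leading = trans (sym (ℤ.*-identityˡ (s (suc m)))) (cong (_* s (suc m)) (sym a0))
    lower : (tl a ⋆ s) m ≡ + 0
    lower = sumTo-zero m _ (λ i _ →
      trans (cong (a (suc i) *_) (IH (s≤s (ℕ.m∸n≤m m i)))) (ℤ.*-zeroʳ (a (suc i))))

-- As u = x · tl u with tl u invertible, c ∘ u ≈ 0 forces c 0 = 0 and then (tl c) ∘ u ≈ 0.
compₛ-injective-𝟘 : ∀ u → u 0 ≡ + 0 → u 1 ≡ + 1 → ∀ c → compₛ c u ≈ₛ 𝟘 → c ≈ₛ 𝟘
compₛ-injective-𝟘 u u0 u1 c c∘u≈0 zero = trans (sym (ℤ.*-identityʳ (c 0))) (c∘u≈0 0)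
compₛ-injective-𝟘 u u0 u1 c c∘u≈0 (suc n) = compₛ-injective-𝟘 u u0 u1 (tl c) tl-c∘u≈0 n
  where
  tl-c∘u : Series
  tl-c∘u = compₛ (tl c) u
  u⋆tl-c∘u≈0 : (u ⋆ tl-c∘u) ≈ₛ 𝟘
  u⋆tl-c∘u≈0 m = begin
    (u ⋆ tl-c∘u) m                           ≡⟨ sym (ℤ.+-identityˡ _) ⟩
    + 0 + (u ⋆ tl-c∘u) m                     ≡⟨ cong (_+ (u ⋆ tl-c∘u) m) (sym (trans (cong (_* oneₛ m) (compₛ-injective-𝟘 u u0 u1 c c∘u≈0 0)) (ℤ.*-zeroˡ (oneₛ m)))) ⟩
    c 0 * oneₛ m + (u ⋆ tl-c∘u) m            ≡⟨ sym (compₛ-unfold c u u0 m) ⟩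
    compₛ c u m                              ≡⟨ c∘u≈0 m ⟩
    + 0                                      ∎
    where open ≡-Reasoning
  u≈X⋆tl-u : u ≈ₛ (Xₛ ⋆ tl u)
  u≈X⋆tl-u = ≈-trans (series-unfold u) (λ m →
    trans (cong (λ z → z * oneₛ m + (Xₛ ⋆ tl u) m) u0) (trans (cong (_+ (Xₛ ⋆ tl u) m) (ℤ.*-zeroˡ (oneₛ m))) (ℤ.+-identityˡ _)))
  tl-u⋆tl-c∘u≈0 : (tl u ⋆ tl-c∘u) ≈ₛ 𝟘
  tl-u⋆tl-c∘u≈0 m = begin
    (tl u ⋆ tl-c∘u) m                        ≡⟨ sym (Xₛ-⋆ (tl u ⋆ tl-c∘u) m) ⟩
    (Xₛ ⋆ (tl u ⋆ tl-c∘u)) (suc m)           ≡⟨ sym (⋆-assoc Xₛ (tl u) tl-c∘u (suc m)) ⟩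
    ((Xₛ ⋆ tl u) ⋆ tl-c∘u) (suc m)           ≡⟨ sym (⋆-congˡ tl-c∘u u≈X⋆tl-u (suc m)) ⟩
    (u ⋆ tl-c∘u) (suc m)                     ≡⟨ u⋆tl-c∘u≈0 (suc m) ⟩
    + 0                                      ∎
    where open ≡-Reasoning
  tl-c∘u≈0 : tl-c∘u ≈ₛ 𝟘
  tl-c∘u≈0 = ⋆-cancel-unit (tl u) tl-c∘u u1 tl-u⋆tl-c∘u≈0

-- u ∘ h − X vanishes after composing with u, and composition with u is injective.
reversion-leftInverse : ∀ h u → h 0 ≡ + 0 → h 1 ≡ + 1 → IsReversion h u → compₛ u h ≈ₛ Xₛ
reversion-leftInverse h u h0 h1 (u0 , h∘u≈X) n =
  ℤ.i-j≡0⇒i≡j _ _ (compₛ-injective-𝟘 u u0 u1 (compₛ u h ⊕ (⊖ Xₛ)) difference∘u≈0 n)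
  where
  u1 : u 1 ≡ + 1
  u1 = begin
    u 1                                                 ≡⟨ sym (simplify (compₛ (tl h) u 1) (u 1)) ⟩
    + 0 + (+ 0 * compₛ (tl h) u 1 + u 1 * (+ 1 * + 1))  ≡⟨ cong₂ (λ p q → + 0 + (p * compₛ (tl h) u 1 + u 1 * (q * + 1))) (sym u0) (sym h1) ⟩
    + 0 + (u 0 * compₛ (tl h) u 1 + u 1 * (h 1 * + 1))  ≡⟨ cong₂ _+_ (sym (ℤ.*-zeroʳ (h 0))) (sym (⋆-unfold u (compₛ (tl h) u) 0)) ⟩
    h 0 * + 0 + (u ⋆ compₛ (tl h) u) 1                  ≡⟨ sym (compₛ-unfold h u u0 1) ⟩
    compₛ h u 1                                         ≡⟨ h∘u≈X 1 ⟩
    + 1                                                 ∎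
    where
    open ≡-Reasoning
    simplify : ∀ x y → + 0 + (+ 0 * x + y * (+ 1 * + 1)) ≡ y
    simplify = solve-∀
  difference∘u≈0 : compₛ (compₛ u h ⊕ (⊖ Xₛ)) u ≈ₛ 𝟘
  difference∘u≈0 = begin
    compₛ (compₛ u h ⊕ (⊖ Xₛ)) u             ≈⟨ compₛ-⊕ (compₛ u h) (⊖ Xₛ) u ⟩
    compₛ (compₛ u h) u ⊕ compₛ (⊖ Xₛ) u     ≈⟨ ⊕-cong (compₛ-assoc h u h0 u0 u) (compₛ-⊖ Xₛ u) ⟩
    compₛ u (compₛ h u) ⊕ (⊖ compₛ Xₛ u)     ≈⟨ ⊕-cong (≈-trans (compₛ-congʳ u h∘u≈X) (compₛ-Xₛ u)) (λ m → cong -_ (Xₛ-compₛ u u0 m)) ⟩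
    u ⊕ (⊖ u)                                ≈⟨ (λ m → ℤ.+-inverseʳ (u m)) ⟩
    𝟘                                        ∎
    where open ≈-Reasoning seriesSetoid

-- The formal derivative

derivₛ-cong : ∀ {a b} → a ≈ₛ b → derivₛ a ≈ₛ derivₛ b
derivₛ-cong e n = cong (+ suc n *_) (e (suc n))

derivₛ-⊕ : ∀ a b → derivₛ (a ⊕ b) ≈ₛ (derivₛ a ⊕ derivₛ b)
derivₛ-⊕ a b n = ℤ.*-distribˡ-+ (+ suc n) (a (suc n)) (b (suc n))

derivₛ-oneₛ : derivₛ oneₛ ≈ₛ 𝟘
derivₛ-oneₛ n = ℤ.*-zeroʳ (+ suc n)

derivₛ-cst : ∀ c → derivₛ (cst c) ≈ₛ 𝟘
derivₛ-cst c n = trans (cong (+ suc n *_) (ℤ.*-zeroʳ c)) (ℤ.*-zeroʳ (+ suc n))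

derivₛ-Xₛ : derivₛ Xₛ ≈ₛ oneₛ
derivₛ-Xₛ zero = refl
derivₛ-Xₛ (suc n) = ℤ.*-zeroʳ (+ suc (suc n))

eulerₛ : Series → Series
eulerₛ a n = + n * a n

eulerₛ-⋆ : ∀ a b → eulerₛ (a ⋆ b) ≈ₛ ((eulerₛ a ⋆ b) ⊕ (a ⋆ eulerₛ b))
eulerₛ-⋆ a b n = trans (sym (sumTo-*ˡ n (+ n) _)) (trans (sumTo-cong-≤ n split) (sumTo-+ n _ _))
  where
  distrib : ∀ p q x y → (p + q) * (x * y) ≡ (p * x) * y + x * (q * y)
  distrib = solve-∀
  split : ∀ i → i ≤ n → + n * (a i * b (n ∸ i)) ≡ (+ i * a i) * b (n ∸ i) + a i * (+ (n ∸ i) * b (n ∸ i))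
  split i i≤n = trans (cong (λ z → + z * (a i * b (n ∸ i))) (sym (ℕ.m+[n∸m]≡n i≤n)))
                      (distrib (+ i) (+ (n ∸ i)) (a i) (b (n ∸ i)))

Xₛ-⋆-derivₛ : ∀ a → (Xₛ ⋆ derivₛ a) ≈ₛ eulerₛ a
Xₛ-⋆-derivₛ a zero = sym (ℤ.*-zeroˡ (a 0))
Xₛ-⋆-derivₛ a (suc n) = Xₛ-⋆ (derivₛ a) n

-- Leibniz's rule is inherited from the Euler operator x d/dx, which is a derivation coefficientwise.
derivₛ-⋆ : ∀ a b → derivₛ (a ⋆ b) ≈ₛ ((derivₛ a ⋆ b) ⊕ (a ⋆ derivₛ b))
derivₛ-⋆ a b n = begin
  derivₛ (a ⋆ b) n                                        ≡⟨ sym (Xₛ-⋆ (derivₛ (a ⋆ b)) n) ⟩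
  (Xₛ ⋆ derivₛ (a ⋆ b)) (suc n)                           ≡⟨ Xₛ-⋆-derivₛ (a ⋆ b) (suc n) ⟩
  eulerₛ (a ⋆ b) (suc n)                                  ≡⟨ eulerₛ-⋆ a b (suc n) ⟩
  ((eulerₛ a ⋆ b) ⊕ (a ⋆ eulerₛ b)) (suc n)               ≡⟨ ⊕-cong (⋆-congˡ b (≈-sym (Xₛ-⋆-derivₛ a))) (⋆-congʳ a (≈-sym (Xₛ-⋆-derivₛ b))) (suc n) ⟩
  (((Xₛ ⋆ derivₛ a) ⋆ b) ⊕ (a ⋆ (Xₛ ⋆ derivₛ b))) (suc n) ≡⟨ factor-Xₛ (suc n) ⟩
  (Xₛ ⋆ ((derivₛ a ⋆ b) ⊕ (a ⋆ derivₛ b))) (suc n)        ≡⟨ Xₛ-⋆ ((derivₛ a ⋆ b) ⊕ (a ⋆ derivₛ b)) n ⟩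
  ((derivₛ a ⋆ b) ⊕ (a ⋆ derivₛ b)) n                     ∎
  where
  open ≡-Reasoning
  factor-Xₛ : (((Xₛ ⋆ derivₛ a) ⋆ b) ⊕ (a ⋆ (Xₛ ⋆ derivₛ b))) ≈ₛ (Xₛ ⋆ ((derivₛ a ⋆ b) ⊕ (a ⋆ derivₛ b)))
  factor-Xₛ = solve 5 (λ x da b a db → ((x :* da) :* b) :+ (a :* (x :* db)) := x :* ((da :* b) :+ (a :* db)))
    ≈-refl Xₛ (derivₛ a) b a (derivₛ b)

tl-derivₛ : ∀ a → tl (derivₛ a) ≈ₛ (derivₛ (tl a) ⊕ tl (tl a))
tl-derivₛ a n = split (+ suc n) (a (suc (suc n)))
  where
  split : ∀ k x → (+ 1 + k) * x ≡ k * x + x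
  split = solve-∀

derivₛ-compₛ : ∀ h → h 0 ≡ + 0 → ∀ a → derivₛ (compₛ a h) ≈ₛ (compₛ (derivₛ a) h ⋆ derivₛ h)
derivₛ-compₛ h h0 a₀ n = <-rec P step n a₀
  where
  P : ℕ → Set
  P n = ∀ a → derivₛ (compₛ a h) n ≡ (compₛ (derivₛ a) h ⋆ derivₛ h) n
  step : ∀ n → (∀ {i} → i < n → P i) → P n
  step n IH a = ≡-via-unfolding (derivₛ h ⋆ a′) h (derivₛ a′) (compₛ (derivₛ (tl a)) h ⋆ derivₛ h) h0
    lhs rhs n (λ i<n → IH i<n (tl a))
    where
    open ≈-Reasoning seriesSetoid
    a′ a″ da′ c : Series
    a′ = compₛ (tl a) h
    a″ = compₛ (tl (tl a)) h
    da′ = compₛ (derivₛ (tl a)) h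
    c = cst (a 1)
    lhs : derivₛ (compₛ a h) ≈ₛ ((derivₛ h ⋆ a′) ⊕ (h ⋆ derivₛ a′))
    lhs = begin
      derivₛ (compₛ a h)                              ≈⟨ derivₛ-cong (compₛ-unfold a h h0) ⟩
      derivₛ (cst (a 0) ⊕ (h ⋆ a′))                   ≈⟨ derivₛ-⊕ (cst (a 0)) (h ⋆ a′) ⟩
      derivₛ (cst (a 0)) ⊕ derivₛ (h ⋆ a′)            ≈⟨ ⊕-cong (derivₛ-cst (a 0)) (derivₛ-⋆ h a′) ⟩
      𝟘 ⊕ ((derivₛ h ⋆ a′) ⊕ (h ⋆ derivₛ a′))         ≈⟨ (λ m → ℤ.+-identityˡ _) ⟩
      (derivₛ h ⋆ a′) ⊕ (h ⋆ derivₛ a′)               ∎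
    rhs : ((derivₛ h ⋆ a′) ⊕ (h ⋆ (da′ ⋆ derivₛ h))) ≈ₛ (compₛ (derivₛ a) h ⋆ derivₛ h)
    rhs = begin
      (derivₛ h ⋆ a′) ⊕ (h ⋆ (da′ ⋆ derivₛ h))
        ≈⟨ ⊕-congˡ (h ⋆ (da′ ⋆ derivₛ h)) (⋆-congʳ (derivₛ h) (compₛ-unfold (tl a) h h0)) ⟩
      (derivₛ h ⋆ (c ⊕ (h ⋆ a″))) ⊕ (h ⋆ (da′ ⋆ derivₛ h))
        ≈⟨ solve 5 (λ dh c h a″ da′ → (dh :* (c :+ (h :* a″))) :+ (h :* (da′ :* dh)) := (c :+ (h :* (da′ :+ a″))) :* dh)
             ≈-refl (derivₛ h) c h a″ da′ ⟩
      (c ⊕ (h ⋆ (da′ ⊕ a″))) ⋆ derivₛ h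
        ≈⟨ ⋆-congˡ (derivₛ h) (⊕-cong (λ m → cong (_* oneₛ m) (sym (ℤ.*-identityˡ (a 1))))
             (⋆-congʳ h (≈-sym (≈-trans (compₛ-congˡ h (tl-derivₛ a)) (compₛ-⊕ (derivₛ (tl a)) (tl (tl a)) h))))) ⟩
      (cst (derivₛ a 0) ⊕ (h ⋆ compₛ (tl (derivₛ a)) h)) ⋆ derivₛ h
        ≈⟨ ⋆-congˡ (derivₛ h) (≈-sym (compₛ-unfold (derivₛ a) h h0)) ⟩
      compₛ (derivₛ a) h ⋆ derivₛ h
        ∎

derivₛ-pow : ∀ a k → derivₛ (powₛ a (suc k)) ≈ₛ (+ suc k · (powₛ a k ⋆ derivₛ a))
derivₛ-pow a zero = begin
  derivₛ (a ⋆ oneₛ)           ≈⟨ derivₛ-cong (≈-trans (⋆-comm a oneₛ) (⋆-identityˡ a)) ⟩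
  derivₛ a                    ≈⟨ ≈-sym (⋆-identityˡ (derivₛ a)) ⟩
  oneₛ ⋆ derivₛ a             ≈⟨ (λ m → sym (ℤ.*-identityˡ _)) ⟩
  + 1 · (oneₛ ⋆ derivₛ a)     ∎
  where open ≈-Reasoning seriesSetoid
derivₛ-pow a (suc k) = begin
  derivₛ (a ⋆ powₛ a (suc k))
    ≈⟨ derivₛ-⋆ a (powₛ a (suc k)) ⟩
  (derivₛ a ⋆ powₛ a (suc k)) ⊕ (a ⋆ derivₛ (powₛ a (suc k)))
    ≈⟨ ⊕-congʳ (derivₛ a ⋆ powₛ a (suc k)) (⋆-congʳ a (≈-trans (derivₛ-pow a k) (≈-sym (cst-⋆ (+ suc k) _)))) ⟩
  (derivₛ a ⋆ (a ⋆ p)) ⊕ (a ⋆ (cst (+ suc k) ⋆ (p ⋆ derivₛ a)))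
    ≈⟨ solve 4 (λ da a p k → (da :* (a :* p)) :+ (a :* (k :* (p :* da))) := (con (+ 1) :+ k) :* ((a :* p) :* da))
         ≈-refl (derivₛ a) a p (cst (+ suc k)) ⟩
  (cst (+ 1) ⊕ cst (+ suc k)) ⋆ ((a ⋆ p) ⋆ derivₛ a)
    ≈⟨ ⋆-congˡ ((a ⋆ p) ⋆ derivₛ a) (λ m → sym (ℤ.*-distribʳ-+ (oneₛ m) (+ 1) (+ suc k))) ⟩
  cst (+ suc (suc k)) ⋆ ((a ⋆ p) ⋆ derivₛ a)
    ≈⟨ cst-⋆ (+ suc (suc k)) ((a ⋆ p) ⋆ derivₛ a) ⟩
  + suc (suc k) · ((a ⋆ p) ⋆ derivₛ a)
    ∎
  where
  open ≈-Reasoning seriesSetoid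
  p : Series
  p = powₛ a k

derivₛ-Xₛ⋆ : ∀ a → derivₛ (Xₛ ⋆ a) ≈ₛ (a ⊕ (Xₛ ⋆ derivₛ a))
derivₛ-Xₛ⋆ a = ≈-trans (derivₛ-⋆ Xₛ a) (⊕-congˡ (Xₛ ⋆ derivₛ a) (≈-trans (⋆-congˡ a derivₛ-Xₛ) (⋆-identityˡ a)))

inverse-zeroCoeff : ∀ f I → f 0 ≡ + 1 → IsInverse f I → I 0 ≡ + 1
inverse-zeroCoeff f I f0 f⋆I≈1 = trans (sym (ℤ.*-identityˡ (I 0))) (trans (cong (_* I 0) (sym f0)) (f⋆I≈1 0))

⋆-derivₛ-inverse : ∀ f I → IsInverse f I → (f ⋆ derivₛ I) ≈ₛ (⊖ (derivₛ f ⋆ I))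
⋆-derivₛ-inverse f I f⋆I≈1 n = begin
  (f ⋆ derivₛ I) n                                          ≡⟨ sym (cancel ((derivₛ f ⋆ I) n) _) ⟩
  - (derivₛ f ⋆ I) n + ((derivₛ f ⋆ I) n + (f ⋆ derivₛ I) n) ≡⟨ cong (_+_ (- (derivₛ f ⋆ I) n)) (sym (derivₛ-⋆ f I n)) ⟩
  - (derivₛ f ⋆ I) n + derivₛ (f ⋆ I) n                     ≡⟨ cong (_+_ (- (derivₛ f ⋆ I) n)) (trans (derivₛ-cong f⋆I≈1 n) (derivₛ-oneₛ n)) ⟩
  - (derivₛ f ⋆ I) n + + 0                                  ≡⟨ ℤ.+-identityʳ _ ⟩
  - (derivₛ f ⋆ I) n                                        ∎
  where
  open ≡-Reasoning
  cancel : ∀ x y → - x + (x + y) ≡ y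
  cancel = solve-∀

sq-⋆-derivₛ-Xₛ⋆inverse : ∀ f I → IsInverse f I →
  ((f ⋆ f) ⋆ derivₛ (Xₛ ⋆ I)) ≈ₛ (f ⊕ (⊖ (Xₛ ⋆ derivₛ f)))
sq-⋆-derivₛ-Xₛ⋆inverse f I f⋆I≈1 = begin
  (f ⋆ f) ⋆ derivₛ (Xₛ ⋆ I)
    ≈⟨ ⋆-congʳ (f ⋆ f) (derivₛ-Xₛ⋆ I) ⟩
  (f ⋆ f) ⋆ (I ⊕ (Xₛ ⋆ derivₛ I))
    ≈⟨ solve 4 (λ f i x di → (f :* f) :* (i :+ (x :* di)) := (f :* (f :* i)) :+ ((x :* f) :* (f :* di))) ≈-refl f I Xₛ (derivₛ I) ⟩
  (f ⋆ (f ⋆ I)) ⊕ ((Xₛ ⋆ f) ⋆ (f ⋆ derivₛ I))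
    ≈⟨ ⊕-cong (⋆-congʳ f f⋆I≈cst1) (⋆-congʳ (Xₛ ⋆ f) (⋆-derivₛ-inverse f I f⋆I≈1)) ⟩
  (f ⋆ cst (+ 1)) ⊕ ((Xₛ ⋆ f) ⋆ (⊖ (derivₛ f ⋆ I)))
    ≈⟨ solve 4 (λ f i x df → (f :* con (+ 1)) :+ ((x :* f) :* (:- (df :* i))) := (f :* con (+ 1)) :+ (:- ((x :* df) :* (f :* i))))
         ≈-refl f I Xₛ (derivₛ f) ⟩
  (f ⋆ cst (+ 1)) ⊕ (⊖ ((Xₛ ⋆ derivₛ f) ⋆ (f ⋆ I)))
    ≈⟨ ⊕-congʳ (f ⋆ cst (+ 1)) (λ n → cong -_ (⋆-congʳ (Xₛ ⋆ derivₛ f) f⋆I≈cst1 n)) ⟩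
  (f ⋆ cst (+ 1)) ⊕ (⊖ ((Xₛ ⋆ derivₛ f) ⋆ cst (+ 1)))
    ≈⟨ solve 2 (λ f xdf → (f :* con (+ 1)) :+ (:- (xdf :* con (+ 1))) := f :+ (:- xdf)) ≈-refl f (Xₛ ⋆ derivₛ f) ⟩
  f ⊕ (⊖ (Xₛ ⋆ derivₛ f))
    ∎
  where
  open ≈-Reasoning seriesSetoid
  f⋆I≈cst1 : (f ⋆ I) ≈ₛ cst (+ 1)
  f⋆I≈cst1 n = trans (f⋆I≈1 n) (sym (ℤ.*-identityˡ (oneₛ n)))

-- The coefficient identity behind Lagrange inversion. Since f² (x/f)′ = f − x f′, for m > 0 it says
-- [x^m] f^m = [x^(m−1)] f^(m−1) f′, which is m [x^m] f^m = [x^(m−1)] (f^m)′.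
pow-⋆-derivₛ-Xₛ⋆inverse : ∀ f I → f 0 ≡ + 1 → IsInverse f I →
  ∀ m → (powₛ f (suc m) ⋆ derivₛ (Xₛ ⋆ I)) m ≡ δ m 0
pow-⋆-derivₛ-Xₛ⋆inverse f I f0 f⋆I≈1 zero
  rewrite Xₛ-⋆ I 0 | f0 | inverse-zeroCoeff f I f0 f⋆I≈1 = refl
pow-⋆-derivₛ-Xₛ⋆inverse f I f0 f⋆I≈1 (suc m) = begin
  (powₛ f (suc (suc m)) ⋆ derivₛ (Xₛ ⋆ I)) (suc m)
    ≡⟨ expand (suc m) ⟩
  powₛ f (suc m) (suc m) + - (Xₛ ⋆ (p ⋆ derivₛ f)) (suc m)
    ≡⟨ cong (λ z → powₛ f (suc m) (suc m) + - z) (Xₛ-⋆ (p ⋆ derivₛ f) m) ⟩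
  powₛ f (suc m) (suc m) + - (p ⋆ derivₛ f) m
    ≡⟨ cong (λ z → z + - (p ⋆ derivₛ f) m) power-rule ⟩
  (p ⋆ derivₛ f) m + - (p ⋆ derivₛ f) m
    ≡⟨ ℤ.+-inverseʳ ((p ⋆ derivₛ f) m) ⟩
  + 0
    ∎
  where
  open ≡-Reasoning
  p : Series
  p = powₛ f m
  expand : (powₛ f (suc (suc m)) ⋆ derivₛ (Xₛ ⋆ I)) ≈ₛ (powₛ f (suc m) ⊕ (⊖ (Xₛ ⋆ (p ⋆ derivₛ f))))
  expand = ≈-trans
    (solve 3 (λ f p dψ → (f :* (f :* p)) :* dψ := p :* ((f :* f) :* dψ)) ≈-refl f p (derivₛ (Xₛ ⋆ I)))
    (≈-trans (⋆-congʳ p (sq-⋆-derivₛ-Xₛ⋆inverse f I f⋆I≈1))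
      (solve 4 (λ f p x df → p :* (f :+ (:- (x :* df))) := (f :* p) :+ (:- (x :* (p :* df)))) ≈-refl f p Xₛ (derivₛ f)))
  power-rule : powₛ f (suc m) (suc m) ≡ (p ⋆ derivₛ f) m
  power-rule = ℤ.*-cancelˡ-≡ (+ suc m) _ _ (derivₛ-pow f m m)

-- Lower-triangular matrices

LowerTriangular : (ℕ → ℕ → ℤ) → Set
LowerTriangular M = ∀ j i → j < i → M j i ≡ + 0

lowerMul-assoc : ∀ A B C → LowerTriangular B → ∀ n k →
  lowerMul (lowerMul A B) C n k ≡ lowerMul A (lowerMul B C) n k
lowerMul-assoc A B C B-lower n k = begin
  sumTo n (λ i → sumTo n (λ j → A n j * B j i) * C i k)
    ≡⟨ sumTo-cong n (λ i → sym (sumTo-*ʳ n (C i k) _)) ⟩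
  sumTo n (λ i → sumTo n (λ j → A n j * B j i * C i k))
    ≡⟨ sumTo-swap n n (λ j i → A n j * B j i * C i k) ⟩
  sumTo n (λ j → sumTo n (λ i → A n j * B j i * C i k))
    ≡⟨ sumTo-cong-≤ n (λ j j≤n → sumTo-extend n _ j≤n (λ i j<i _ → above-diagonal j i j<i)) ⟩
  sumTo n (λ j → sumTo j (λ i → A n j * B j i * C i k))
    ≡⟨ sumTo-cong n (λ j → trans (sumTo-cong j (λ i → ℤ.*-assoc (A n j) (B j i) (C i k))) (sumTo-*ˡ j (A n j) _)) ⟩
  sumTo n (λ j → A n j * sumTo j (λ i → B j i * C i k))
    ∎
  where
  open ≡-Reasoning
  above-diagonal : ∀ j i → j < i → A n j * B j i * C i k ≡ + 0
  above-diagonal j i j<i rewrite B-lower j i j<i | ℤ.*-zeroʳ (A n j) = ℤ.*-zeroˡ (C i k)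

lowerMul-δˡ : ∀ M n k → lowerMul δ M n k ≡ M n k
lowerMul-δˡ M n k = trans
  (sumTo-cong n (λ j → trans (cong (_* M j k) (δ-sym n j)) (ℤ.*-comm (δ j n) (M j k))))
  (sumTo-*δ-≤ n n (λ j → M j k) ℕ.≤-refl)

lowerMul-δʳ : ∀ M → LowerTriangular M → ∀ n k → lowerMul M δ n k ≡ M n k
lowerMul-δʳ M M-lower n k with ℕ.≤-<-connex k n
... | inj₁ k≤n = sumTo-*δ-≤ n k (M n) k≤n
... | inj₂ n<k = trans (sumTo-*δ-< n k (M n) n<k) (sym (M-lower n k n<k))

-- C (R C) = (C R) C = C δ, and C is unitriangular, so the rows of R C are forced one by one.
lowerMul-leftInverse : ∀ C R → LowerTriangular C → LowerTriangular R → (∀ n → C n n ≡ + 1) →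
  (∀ n k → lowerMul C R n k ≡ δ n k) → ∀ n k → lowerMul R C n k ≡ δ n k
lowerMul-leftInverse C R C-lower R-lower C-unit C⋆R≡δ = <-rec (λ n → ∀ k → M n k ≡ δ n k) step
  where
  M : ℕ → ℕ → ℤ
  M = lowerMul R C
  cancel-unit : ∀ {u x y} → u ≡ + 1 → u * x ≡ u * y → x ≡ y
  cancel-unit refl e = trans (sym (ℤ.*-identityˡ _)) (trans e (ℤ.*-identityˡ _))
  C⋆M≡C⋆δ : ∀ n k → lowerMul C M n k ≡ lowerMul C δ n k
  C⋆M≡C⋆δ n k = begin
    lowerMul C M n k               ≡⟨ sym (lowerMul-assoc C R C R-lower n k) ⟩
    lowerMul (lowerMul C R) C n k  ≡⟨ sumTo-cong n (λ j → cong (_* C j k) (C⋆R≡δ n j)) ⟩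
    lowerMul δ C n k               ≡⟨ lowerMul-δˡ C n k ⟩
    C n k                          ≡⟨ sym (lowerMul-δʳ C C-lower n k) ⟩
    lowerMul C δ n k               ∎
    where open ≡-Reasoning
  step : ∀ n → (∀ {i} → i < n → ∀ k → M i k ≡ δ i k) → ∀ k → M n k ≡ δ n k
  step zero _ k = cancel-unit (C-unit 0) (C⋆M≡C⋆δ 0 k)
  step (suc m) IH k = cancel-unit (C-unit (suc m)) (∙-cancelˡ (sumTo m (λ j → C (suc m) j * δ j k)) _ _ (begin
    sumTo m (λ j → C (suc m) j * δ j k) + C (suc m) (suc m) * M (suc m) k
      ≡⟨ cong (_+ C (suc m) (suc m) * M (suc m) k) (sumTo-cong-≤ m (λ j j≤m → cong (C (suc m) j *_) (sym (IH (s≤s j≤m) k)))) ⟩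
    lowerMul C M (suc m) k
      ≡⟨ C⋆M≡C⋆δ (suc m) k ⟩
    lowerMul C δ (suc m) k
      ∎))
    where open ≡-Reasoning

-- Inverting c(A;r)

powₛ-isInverse : ∀ f I → IsInverse f I → ∀ k → IsInverse (powₛ f k) (powₛ I k)
powₛ-isInverse f I f⋆I≈1 k = ≈-trans (≈-sym (powₛ-⋆ f I k)) (≈-trans (powₛ-cong f⋆I≈1 k) (powₛ-oneₛ k))

powPred-cong : ∀ {a a′ b b′} → a ≈ₛ a′ → b ≈ₛ b′ → ∀ r → powPred a b r ≈ₛ powPred a′ b′ r
powPred-cong a≈a′ b≈b′ zero = b≈b′
powPred-cong a≈a′ b≈b′ (suc r) = powₛ-cong a≈a′ r

powₛ-+-powPred : ∀ f I → IsInverse f I → ∀ r m → powₛ f (m ℕ.+ r) ≈ₛ (powₛ f (suc m) ⋆ powPred f I r)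
powₛ-+-powPred f I f⋆I≈1 zero m = begin
  powₛ f (m ℕ.+ 0)           ≈⟨ (λ n → cong (λ z → powₛ f z n) (ℕ.+-identityʳ m)) ⟩
  powₛ f m                   ≈⟨ ≈-sym (⋆-identityˡ (powₛ f m)) ⟩
  oneₛ ⋆ powₛ f m            ≈⟨ ⋆-congˡ (powₛ f m) (≈-sym f⋆I≈1) ⟩
  (f ⋆ I) ⋆ powₛ f m         ≈⟨ solve 3 (λ f i p → (f :* i) :* p := (f :* p) :* i) ≈-refl f I (powₛ f m) ⟩
  (f ⋆ powₛ f m) ⋆ I         ∎
  where open ≈-Reasoning seriesSetoid
powₛ-+-powPred f I f⋆I≈1 (suc r) m =
  ≈-trans (λ n → cong (λ z → powₛ f z n) (ℕ.+-suc m r)) (powₛ-+ f (suc m) r)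

⋆-inverse-unique : ∀ a b c → IsInverse a b → IsInverse a c → b ≈ₛ c
⋆-inverse-unique a b c a⋆b≈1 a⋆c≈1 = begin
  b                ≈⟨ ≈-sym (⋆-identityˡ b) ⟩
  oneₛ ⋆ b         ≈⟨ ⋆-congˡ b (≈-sym a⋆c≈1) ⟩
  (a ⋆ c) ⋆ b      ≈⟨ solve 3 (λ a b c → (a :* c) :* b := (a :* b) :* c) ≈-refl a b c ⟩
  (a ⋆ b) ⋆ c      ≈⟨ ⋆-congˡ c a⋆b≈1 ⟩
  oneₛ ⋆ c         ≈⟨ ⋆-identityˡ c ⟩
  c                ∎
  where open ≈-Reasoning seriesSetoid

compₛ-isInverse : ∀ h → h 0 ≡ + 0 → ∀ a b → IsInverse a b → IsInverse (compₛ a h) (compₛ b h)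
compₛ-isInverse h h0 a b a⋆b≈1 =
  ≈-trans (≈-sym (compₛ-⋆ h h0 a b)) (≈-trans (compₛ-congˡ h a⋆b≈1) (compₛ-oneₛ h h0))

compₛ-cancelʳ : ∀ v v̄ → v 0 ≡ + 0 → v̄ 0 ≡ + 0 → compₛ v̄ v ≈ₛ Xₛ → ∀ a → compₛ (compₛ a v̄) v ≈ₛ a
compₛ-cancelʳ v v̄ v0 v̄0 v̄∘v≈X a =
  ≈-trans (compₛ-assoc v̄ v v̄0 v0 a) (≈-trans (compₛ-congʳ a v̄∘v≈X) (compₛ-Xₛ a))

derivₛ-reversion-isInverse : ∀ φ ψ → ψ 0 ≡ + 0 → compₛ φ ψ ≈ₛ Xₛ → IsInverse (compₛ (derivₛ φ) ψ) (derivₛ ψ)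
derivₛ-reversion-isInverse φ ψ ψ0 φ∘ψ≈X =
  ≈-trans (≈-sym (derivₛ-compₛ ψ ψ0 φ)) (≈-trans (derivₛ-cong φ∘ψ≈X) derivₛ-Xₛ)

-- Composing with v turns the hypothesis into (φ′ ∘ ψ) · g · f^(r−1) · d(v) = 1,
-- while the chain rule gives (φ′ ∘ ψ) · ψ′ = 1.
g⋆[d∘v⋆f^[r-1]]≈ψ′ : ∀ g f I d r φ ψ v v̄ → ψ 0 ≡ + 0 → v 0 ≡ + 0 → v̄ 0 ≡ + 0 →
  compₛ φ ψ ≈ₛ Xₛ → compₛ v̄ v ≈ₛ Xₛ →
  IsInverse (compₛ (derivₛ φ) (compₛ ψ v̄) ⋆ (compₛ g v̄ ⋆ powPred (compₛ f v̄) (compₛ I v̄) r)) d →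
  (g ⋆ (compₛ d v ⋆ powPred f I r)) ≈ₛ derivₛ ψ
g⋆[d∘v⋆f^[r-1]]≈ψ′ g f I d r φ ψ v v̄ ψ0 v0 v̄0 φ∘ψ≈X v̄∘v≈X W⋆d≈1 =
  ⋆-inverse-unique Φ _ _ Φ⋆g⋆E⋆P≈1 (derivₛ-reversion-isInverse φ ψ ψ0 φ∘ψ≈X)
  where
  open ≈-Reasoning seriesSetoid
  Φ P E φ′∘H g∘v̄ P∘v̄ W : Series
  Φ = compₛ (derivₛ φ) ψ
  P = powPred f I r
  E = compₛ d v
  φ′∘H = compₛ (derivₛ φ) (compₛ ψ v̄)
  g∘v̄ = compₛ g v̄
  P∘v̄ = powPred (compₛ f v̄) (compₛ I v̄) r
  W = φ′∘H ⋆ (g∘v̄ ⋆ P∘v̄)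
  cancel : ∀ a → compₛ (compₛ a v̄) v ≈ₛ a
  cancel = compₛ-cancelʳ v v̄ v0 v̄0 v̄∘v≈X
  W∘v : compₛ W v ≈ₛ (Φ ⋆ (g ⋆ P))
  W∘v = ≈-trans (compₛ-⋆ v v0 φ′∘H (g∘v̄ ⋆ P∘v̄)) (⋆-cong
    (≈-trans (compₛ-assoc (compₛ ψ v̄) v (cong (_* + 1) ψ0) v0 (derivₛ φ)) (compₛ-congʳ (derivₛ φ) (cancel ψ)))
    (≈-trans (compₛ-⋆ v v0 g∘v̄ P∘v̄) (⋆-cong (cancel g)
      (≈-trans (compₛ-powPred v v0 (compₛ f v̄) (compₛ I v̄) r) (powPred-cong (cancel f) (cancel I) r)))))
  Φ⋆g⋆E⋆P≈1 : IsInverse Φ (g ⋆ (E ⋆ P))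
  Φ⋆g⋆E⋆P≈1 = begin
    Φ ⋆ (g ⋆ (E ⋆ P))      ≈⟨ solve 4 (λ Φ g e p → Φ :* (g :* (e :* p)) := (Φ :* (g :* p)) :* e) ≈-refl Φ g E P ⟩
    (Φ ⋆ (g ⋆ P)) ⋆ E      ≈⟨ ⋆-congˡ E (≈-sym W∘v) ⟩
    compₛ W v ⋆ E          ≈⟨ compₛ-isInverse v v0 W d W⋆d≈1 ⟩
    oneₛ                   ∎

⋆-powₛ-Xₛ⋆ : ∀ a f p → (a ⋆ powₛ (Xₛ ⋆ f) p) ≈ₛ (powₛ Xₛ p ⋆ (a ⋆ powₛ f p))
⋆-powₛ-Xₛ⋆ a f p = ≈-trans (⋆-congʳ a (powₛ-⋆ Xₛ f p))
  (solve 3 (λ a x y → a :* (x :* y) := x :* (a :* y)) ≈-refl a (powₛ Xₛ p) (powₛ f p))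

cMat-entry : ∀ g f r n j →
  cMat g f r n j ≡ ((g ⋆ powₛ (Xₛ ⋆ f) (n ℕ.+ r)) ⋆ powₛ (Xₛ ⋆ f) j) (n ℕ.+ n ℕ.+ r)
cMat-entry g f r n j = trans
  (cong (λ z → (g ⋆ powₛ (Xₛ ⋆ f) z) (n ℕ.+ n ℕ.+ r)) (reorder n j r))
  (trans (⋆-congʳ g (powₛ-+ (Xₛ ⋆ f) (n ℕ.+ r) j) (n ℕ.+ n ℕ.+ r))
         (sym (⋆-assoc g (powₛ (Xₛ ⋆ f) (n ℕ.+ r)) (powₛ (Xₛ ⋆ f) j) (n ℕ.+ n ℕ.+ r))))
  where
  reorder : ∀ n j r → n ℕ.+ j ℕ.+ r ≡ (n ℕ.+ r) ℕ.+ j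
  reorder = ℕ-Solver.solve-∀

n+n+r<n+r+j : ∀ {n j} r → n < j → n ℕ.+ n ℕ.+ r < (n ℕ.+ r) ℕ.+ j
n+n+r<n+r+j {n} {j} r n<j = subst (ℕ._< (n ℕ.+ r) ℕ.+ j) (sym (reorder n r)) (ℕ.+-monoʳ-< (n ℕ.+ r) n<j)
  where
  reorder : ∀ n r → n ℕ.+ n ℕ.+ r ≡ (n ℕ.+ r) ℕ.+ n
  reorder = ℕ-Solver.solve-∀

cMat-entry-vanishes : ∀ g f r {n j} → n < j →
  ((g ⋆ powₛ (Xₛ ⋆ f) (n ℕ.+ r)) ⋆ powₛ (Xₛ ⋆ f) j) (n ℕ.+ n ℕ.+ r) ≡ + 0
cMat-entry-vanishes g f r {n} {j} n<j =
  vanishesBelow-⋆ {p = n ℕ.+ r} {q = j} (vanishesBelow-⋆ {g} {p = 0} (λ _ ()) (vanishesBelow-pow _ refl (n ℕ.+ r)))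
    (vanishesBelow-pow _ refl j) _ (n+n+r<n+r+j r n<j)

cMat-lowerTriangular : ∀ g f r → LowerTriangular (cMat g f r)
cMat-lowerTriangular g f r n j n<j = trans (cMat-entry g f r n j) (cMat-entry-vanishes g f r n<j)

cMat-diagonal : ∀ g f r → g 0 ≡ + 1 → f 0 ≡ + 1 → ∀ n → cMat g f r n n ≡ + 1
cMat-diagonal g f r g0 f0 n = begin
  (g ⋆ powₛ (Xₛ ⋆ f) p) p                ≡⟨ ⋆-powₛ-Xₛ⋆ g f p p ⟩
  (powₛ Xₛ p ⋆ (g ⋆ powₛ f p)) p         ≡⟨ cong (powₛ Xₛ p ⋆ (g ⋆ powₛ f p)) (sym (ℕ.+-identityʳ p)) ⟩
  (powₛ Xₛ p ⋆ (g ⋆ powₛ f p)) (p ℕ.+ 0) ≡⟨ powₛ-Xₛ-⋆-shift p (g ⋆ powₛ f p) 0 ⟩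
  g 0 * powₛ f p 0                       ≡⟨ cong₂ _*_ g0 (powₛ-zeroCoeff f f0 p) ⟩
  + 1                                    ∎
  where
  open ≡-Reasoning
  p : ℕ
  p = n ℕ.+ n ℕ.+ r

cMat-row-⋆ : ∀ g f r s n → let v = Xₛ ⋆ f in
  sumTo n (λ j → cMat g f r n j * s j) ≡ ((g ⋆ powₛ v (n ℕ.+ r)) ⋆ compₛ s v) (n ℕ.+ n ℕ.+ r)
cMat-row-⋆ g f r s n = begin
  sumTo n (λ j → cMat g f r n j * s j)
    ≡⟨ sumTo-cong n (λ j → trans (cong (_* s j) (cMat-entry g f r n j)) (ℤ.*-comm _ (s j))) ⟩
  sumTo n (λ j → s j * (t ⋆ powₛ v j) N)
    ≡⟨ sym (sumTo-extend N _ n≤N (λ j n<j _ → trans (cong (s j *_) (cMat-entry-vanishes g f r n<j)) (ℤ.*-zeroʳ (s j)))) ⟩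
  sumTo N (λ j → s j * (t ⋆ powₛ v j) N)
    ≡⟨ sym (⋆-compₛ t s v refl N) ⟩
  (t ⋆ compₛ s v) N
    ∎
  where
  open ≡-Reasoning
  v t : Series
  v = Xₛ ⋆ f
  t = g ⋆ powₛ v (n ℕ.+ r)
  N : ℕ
  N = n ℕ.+ n ℕ.+ r
  n≤N : n ≤ N
  n≤N = ℕ.≤-trans (ℕ.m≤m+n n n) (ℕ.m≤m+n (n ℕ.+ n) r)

riordan-lowerTriangular : ∀ d H → H 0 ≡ + 0 → LowerTriangular (riordan d H)
riordan-lowerTriangular d H H0 j i j<i =
  vanishesBelow-⋆ {d} {powₛ H i} {0} (λ _ ()) (vanishesBelow-pow H H0 i) j j<i

cMat⋆riordan-coeff : ∀ g f I d H r → compₛ H (Xₛ ⋆ f) ≈ₛ (Xₛ ⋆ I) → ∀ n k →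
  lowerMul (cMat g f r) (riordan d H) n k
    ≡ (powₛ Xₛ ((n ℕ.+ r) ℕ.+ k) ⋆ (((g ⋆ powₛ f (n ℕ.+ r)) ⋆ compₛ d (Xₛ ⋆ f)) ⋆ powₛ I k)) (n ℕ.+ n ℕ.+ r)
cMat⋆riordan-coeff g f I d H r H∘v≈ψ n k =
  trans (cMat-row-⋆ g f r (d ⋆ powₛ H k) n) (rearrange (n ℕ.+ n ℕ.+ r))
  where
  open ≈-Reasoning seriesSetoid
  v : Series
  v = Xₛ ⋆ f
  p : ℕ
  p = n ℕ.+ r
  E : Series
  E = compₛ d v
  rearrange : ((g ⋆ powₛ v p) ⋆ compₛ (d ⋆ powₛ H k) v)
            ≈ₛ (powₛ Xₛ (p ℕ.+ k) ⋆ (((g ⋆ powₛ f p) ⋆ E) ⋆ powₛ I k))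
  rearrange = begin
    (g ⋆ powₛ v p) ⋆ compₛ (d ⋆ powₛ H k) v
      ≈⟨ ⋆-congʳ (g ⋆ powₛ v p) (≈-trans (compₛ-⋆ v refl d (powₛ H k))
           (⋆-congʳ E (≈-trans (compₛ-pow v refl H k) (powₛ-cong H∘v≈ψ k)))) ⟩
    (g ⋆ powₛ v p) ⋆ (E ⋆ powₛ (Xₛ ⋆ I) k)
      ≈⟨ ⋆-cong (⋆-powₛ-Xₛ⋆ g f p) (⋆-powₛ-Xₛ⋆ E I k) ⟩
    (powₛ Xₛ p ⋆ (g ⋆ powₛ f p)) ⋆ (powₛ Xₛ k ⋆ (E ⋆ powₛ I k))
      ≈⟨ solve 6 (λ xp g fp xk e ik → (xp :* (g :* fp)) :* (xk :* (e :* ik)) := (xp :* xk) :* (((g :* fp) :* e) :* ik))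
           ≈-refl (powₛ Xₛ p) g (powₛ f p) (powₛ Xₛ k) E (powₛ I k) ⟩
    (powₛ Xₛ p ⋆ powₛ Xₛ k) ⋆ (((g ⋆ powₛ f p) ⋆ E) ⋆ powₛ I k)
      ≈⟨ ⋆-congˡ (((g ⋆ powₛ f p) ⋆ E) ⋆ powₛ I k) (≈-sym (powₛ-+ Xₛ p k)) ⟩
    powₛ Xₛ (p ℕ.+ k) ⋆ (((g ⋆ powₛ f p) ⋆ E) ⋆ powₛ I k)
      ∎

g⋆f^[k+m+r]⋆E⋆I^k≈f^[1+m]⋆w : ∀ g f I E w r → IsInverse f I → (g ⋆ (E ⋆ powPred f I r)) ≈ₛ w →
  ∀ k m → (((g ⋆ powₛ f ((k ℕ.+ m) ℕ.+ r)) ⋆ E) ⋆ powₛ I k) ≈ₛ (powₛ f (suc m) ⋆ w)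
g⋆f^[k+m+r]⋆E⋆I^k≈f^[1+m]⋆w g f I E w r f⋆I≈1 g⋆E⋆P≈w k m = begin
  ((g ⋆ powₛ f ((k ℕ.+ m) ℕ.+ r)) ⋆ E) ⋆ Iᵏ
    ≈⟨ ⋆-congˡ Iᵏ (⋆-congˡ E (⋆-congʳ g split)) ⟩
  ((g ⋆ (fᵏ ⋆ (f¹⁺ᵐ ⋆ P))) ⋆ E) ⋆ Iᵏ
    ≈⟨ solve 6 (λ g fk f1 p e ik → ((g :* (fk :* (f1 :* p))) :* e) :* ik := (fk :* ik) :* (f1 :* (g :* (e :* p))))
         ≈-refl g fᵏ f¹⁺ᵐ P E Iᵏ ⟩
  (fᵏ ⋆ Iᵏ) ⋆ (f¹⁺ᵐ ⋆ (g ⋆ (E ⋆ P)))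
    ≈⟨ ⋆-cong (powₛ-isInverse f I f⋆I≈1 k) (⋆-congʳ f¹⁺ᵐ g⋆E⋆P≈w) ⟩
  oneₛ ⋆ (f¹⁺ᵐ ⋆ w)
    ≈⟨ ⋆-identityˡ _ ⟩
  f¹⁺ᵐ ⋆ w
    ∎
  where
  open ≈-Reasoning seriesSetoid
  fᵏ Iᵏ f¹⁺ᵐ P : Series
  fᵏ = powₛ f k
  Iᵏ = powₛ I k
  f¹⁺ᵐ = powₛ f (suc m)
  P = powPred f I r
  split : powₛ f ((k ℕ.+ m) ℕ.+ r) ≈ₛ (fᵏ ⋆ (f¹⁺ᵐ ⋆ P))
  split = ≈-trans (λ n → cong (λ z → powₛ f z n) (ℕ.+-assoc k m r))
            (≈-trans (powₛ-+ f k (m ℕ.+ r)) (⋆-congʳ fᵏ (powₛ-+-powPred f I f⋆I≈1 r m)))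

cMat⋆riordan≡δ : ∀ g f I d H r → f 0 ≡ + 1 → IsInverse f I → compₛ H (Xₛ ⋆ f) ≈ₛ (Xₛ ⋆ I) →
  (g ⋆ (compₛ d (Xₛ ⋆ f) ⋆ powPred f I r)) ≈ₛ derivₛ (Xₛ ⋆ I) →
  ∀ n k → lowerMul (cMat g f r) (riordan d H) n k ≡ δ n k
cMat⋆riordan≡δ g f I d H r f0 f⋆I≈1 H∘v≈ψ g⋆E⋆P≈ψ′ n k with ℕ.≤-<-connex k n
... | inj₁ k≤n = subst (λ n → lowerMul (cMat g f r) (riordan d H) n k ≡ δ n k) (ℕ.m+[n∸m]≡n k≤n) (on-or-below (n ∸ k))
  where
  on-or-below : ∀ m → lowerMul (cMat g f r) (riordan d H) (k ℕ.+ m) k ≡ δ (k ℕ.+ m) k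
  on-or-below m = begin
    lowerMul (cMat g f r) (riordan d H) (k ℕ.+ m) k
      ≡⟨ cMat⋆riordan-coeff g f I d H r H∘v≈ψ (k ℕ.+ m) k ⟩
    (powₛ Xₛ q ⋆ W) ((k ℕ.+ m) ℕ.+ (k ℕ.+ m) ℕ.+ r)
      ≡⟨ cong (powₛ Xₛ q ⋆ W) (reorder k m r) ⟩
    (powₛ Xₛ q ⋆ W) (q ℕ.+ m)
      ≡⟨ powₛ-Xₛ-⋆-shift q W m ⟩
    W m
      ≡⟨ g⋆f^[k+m+r]⋆E⋆I^k≈f^[1+m]⋆w g f I (compₛ d (Xₛ ⋆ f)) (derivₛ (Xₛ ⋆ I)) r f⋆I≈1 g⋆E⋆P≈ψ′ k m m ⟩
    (powₛ f (suc m) ⋆ derivₛ (Xₛ ⋆ I)) m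
      ≡⟨ pow-⋆-derivₛ-Xₛ⋆inverse f I f0 f⋆I≈1 m ⟩
    δ m 0
      ≡⟨ sym (δ-+ˡ k m) ⟩
    δ (k ℕ.+ m) k
      ∎
    where
    open ≡-Reasoning
    q : ℕ
    q = ((k ℕ.+ m) ℕ.+ r) ℕ.+ k
    W : Series
    W = ((g ⋆ powₛ f ((k ℕ.+ m) ℕ.+ r)) ⋆ compₛ d (Xₛ ⋆ f)) ⋆ powₛ I k
    reorder : ∀ k m r → (k ℕ.+ m) ℕ.+ (k ℕ.+ m) ℕ.+ r ≡ (((k ℕ.+ m) ℕ.+ r) ℕ.+ k) ℕ.+ m
    reorder = ℕ-Solver.solve-∀
... | inj₂ n<k = trans (cMat⋆riordan-coeff g f I d H r H∘v≈ψ n k)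
  (trans (powₛ-Xₛ-⋆-vanishesBelow ((n ℕ.+ r) ℕ.+ k) (((g ⋆ powₛ f (n ℕ.+ r)) ⋆ compₛ d (Xₛ ⋆ f)) ⋆ powₛ I k)
           (n ℕ.+ n ℕ.+ r) (n+n+r<n+r+j r n<k)) (sym (δ-≢ (λ n≡k → ℕ.<-irrefl n≡k n<k))))

mainTheorem16 : (g f : Series) → g 0 ≡ + 1 → f 0 ≡ + 1 →
    (finv : Series) → IsInverse f finv →
    (φ : Series) → IsReversion (Xₛ ⋆ finv) φ →
    (vbar : Series) → IsReversion (Xₛ ⋆ f) vbar →
    (r : ℕ) →
    (d : Series) →
    IsInverse (compₛ (derivₛ φ) (compₛ (Xₛ ⋆ finv) vbar) ⋆ (compₛ g vbar ⋆ powPred (compₛ f vbar) (compₛ finv vbar) r)) d →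
    ((n k : ℕ) → lowerMul (cMat g f r) (riordan d (compₛ (Xₛ ⋆ finv) vbar)) n k ≡ δ n k) ×
    ((n k : ℕ) → lowerMul (riordan d (compₛ (Xₛ ⋆ finv) vbar)) (cMat g f r) n k ≡ δ n k)
mainTheorem16 g f g0 f0 I f⋆I≈1 φ φ-reversion v̄ v̄-reversion@(v̄0 , _) r d W⋆d≈1 =
  c⋆R≡δ , lowerMul-leftInverse (cMat g f r) (riordan d H) (cMat-lowerTriangular g f r)
            (riordan-lowerTriangular d H refl) (cMat-diagonal g f r g0 f0) c⋆R≡δ
  where
  ψ v H : Series
  ψ = Xₛ ⋆ I
  v = Xₛ ⋆ f
  H = compₛ ψ v̄
  φ∘ψ≈X : compₛ φ ψ ≈ₛ Xₛ
  φ∘ψ≈X = reversion-leftInverse ψ φ refl (trans (Xₛ-⋆ I 0) (inverse-zeroCoeff f I f0 f⋆I≈1)) φ-reversion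
  v̄∘v≈X : compₛ v̄ v ≈ₛ Xₛ
  v̄∘v≈X = reversion-leftInverse v v̄ refl (trans (Xₛ-⋆ f 0) f0) v̄-reversion
  c⋆R≡δ : ∀ n k → lowerMul (cMat g f r) (riordan d H) n k ≡ δ n k
  c⋆R≡δ = cMat⋆riordan≡δ g f I d H r f0 f⋆I≈1 (compₛ-cancelʳ v v̄ refl v̄0 v̄∘v≈X ψ)
            (g⋆[d∘v⋆f^[r-1]]≈ψ′ g f I d r φ ψ v v̄ refl refl v̄0 φ∘ψ≈X v̄∘v≈X W⋆d≈1)
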